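{- Let $m\ge1$, $k\ge m$ and $h$ be integers. The generating function $\sum_{n\ge0}a(n)q^n$, where $a(n)$ is the number of partitions $\lambda$ of $n$ with an $h$-fixed hook in the $m$th column arising from a part of size $k$ (i.e. there is a row $s$ with $\lambda_s=k$ and $h_{s,m}(\lambda)=s+h$), is \[ \sum_{s=k-h-m+1}^{\infty}\frac{q^{s(k+m)+m(h-k+m-1)}}{(q;q)_{s-1}(q;q)_{m-1}}\binom{s+h-1}{k-m}_q =\sum_{s=0}^{\infty}\frac{q^{s(k+m)+k(k-h-m+1)}}{(q;q)_{s+k-h-m}(q;q)_{m-1}}\binom{s+k-m}{k-m}_q . \]
   Context: For a partition $\lambda$ with conjugate $\lambda'$, $h_{i,j}(\lambda)=\lambda_i+\lambda'_j-i-j+1$ is the hook length of cell $(i,j)$, $j\le\lambda_i$. Notation: $(a;b)_n=\prod_{t=0}^{n-1}(1-ab^t)$, and the Gaussian binomial coefficient is $\binom{a}{b}_q=\frac{(q;q)_a}{(q;q)_b(q;q)_{a-b}}$, with the standard conventions that $1/(q;q)_j=0$ for $j<0$ and $\binom{a}{b}_q=0$ unless $0\le b\le a$. -}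

module Defs where

open import Data.Nat as ℕ using (ℕ; zero; suc; _≤_; _≤?_; _∸_)
open import Data.Nat.Divisibility using (_∣?_)
open import Data.Integer as ℤ using (ℤ; +_; -[1+_]; _+_; _-_; _*_; -_)
open import Data.List using (List; []; _∷_; length; filter)
open import Data.Nat.ListAction using (sum)
open import Data.List.Relation.Unary.All using (All)
open import Data.Product using (Σ; _×_)
open import Relation.Binary.PropositionalEquality using (_≡_)
open import Relation.Nullary using (does)
open import Data.Bool using (if_then_else_)

-- Formal power series in q with integer coefficients (n ↦ [q^n])

Series : Set
Series = ℕ → ℤ

sumTo : ℕ → (ℕ → ℤ) → ℤ
sumTo zero    f = + 0
sumTo (suc n) f = sumTo n f + f n

zeroS : Series
zeroS _ = + 0

oneS : Series
oneS zero    = + 1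
oneS (suc _) = + 0

infixl 7 _⊛_
_⊛_ : Series → Series → Series
(F ⊛ G) n = sumTo (suc n) (λ i → F i * G (n ∸ i))

-- the polynomial 1 - q^i   (used for i ≥ 1)
oneMinusQ : ℕ → Series
oneMinusQ i n = if does (n ℕ.≟ 0) then + 1
                else (if does (n ℕ.≟ i) then - (+ 1) else + 0)

-- 1/(1 - q^i) = Σ_t q^{i t}   (used for i ≥ 1)
geom : ℕ → Series
geom i n = if does (i ∣? n) then + 1 else + 0

poch : ℕ → Series
poch zero    = oneS
poch (suc a) = poch a ⊛ oneMinusQ (suc a)

invPoch : ℕ → Series
invPoch zero    = oneS
invPoch (suc a) = invPoch a ⊛ geom (suc a)

-- 1/(q;q)_j for integer j, with the convention 1/(q;q)_j = 0 for j < 0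
invPochℤ : ℤ → Series
invPochℤ (+ j)      = invPoch j
invPochℤ -[1+ _ ]   = zeroS

-- Gaussian binomial [a choose b]_q = (q;q)_a / ((q;q)_b (q;q)_{a-b}),
-- and 0 unless 0 ≤ b ≤ a
gauss : ℤ → ℤ → Series
gauss (+ a) (+ b) = if does (b ≤? a) then poch a ⊛ invPoch b ⊛ invPoch (a ∸ b) else zeroS
gauss (+ a) -[1+ _ ] = zeroS
gauss -[1+ _ ] _     = zeroS

-- multiplication by q^e (e ∈ ℤ); coefficients at negative powers are discarded
shift : ℤ → Series → Series
shift e F n with (+ n) - e
... | + d      = F d
... | -[1+ _ ] = + 0

Nonincreasing : List ℕ → Set
Nonincreasing []           = Data.Unit.⊤ where import Data.Unit
Nonincreasing (x ∷ [])     = Data.Unit.⊤ where import Data.Unit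
Nonincreasing (x ∷ y ∷ xs) = (y ≤ x) × Nonincreasing (y ∷ xs)

IsPartitionOf : ℕ → List ℕ → Set
IsPartitionOf n p = Nonincreasing p × All (λ x → 1 ≤ x) p × sum p ≡ n

-- λ_i (1-indexed), 0 if i = 0 or i exceeds the number of parts
part : List ℕ → ℕ → ℕ
part []       _             = 0
part (x ∷ xs) zero          = 0
part (x ∷ xs) (suc zero)    = x
part (x ∷ xs) (suc (suc i)) = part xs (suc i)

conj : List ℕ → ℕ → ℕ
conj p j = length (filter (λ x → j ≤? x) p)

hook : List ℕ → ℕ → ℕ → ℤ
hook p i j = + part p i + + conj p j - + i - + j + + 1

FixedHookAt : ℕ → ℕ → ℤ → List ℕ → Set
FixedHookAt m k h p = Σ ℕ λ s → (1 ≤ s) × (part p s ≡ k) × (hook p s m ≡ + s + h)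

term₁ : ℕ → ℕ → ℤ → ℕ → Series
term₁ m k h t =
  let s = (+ k - h - + m + + 1) + + t in
  shift (s * (+ k + + m) + + m * (h - + k + + m - + 1))
        (invPochℤ (s - + 1) ⊛ invPoch (m ∸ 1) ⊛ gauss (s + h - + 1) (+ k - + m))

term₂ : ℕ → ℕ → ℤ → ℕ → Series
term₂ m k h t =
  let s = + t in
  shift (s * (+ k + + m) + + k * (+ k - h - + m + + 1))
        (invPochℤ (s + + k - h - + m) ⊛ invPoch (m ∸ 1) ⊛ gauss (s + + k - + m) (+ k - + m))

partial : (ℕ → Series) → ℕ → ℕ → ℤ
partial T M n = sumTo (suc M) (λ t → T t n)

-- the infinite sum Σ_t T t has coefficient c at q^n
-- (partial sums eventually stabilise at c)
HasCoeff : (ℕ → Series) → ℕ → ℤ → Set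
HasCoeff T n c = Σ ℕ λ N → (M : ℕ) → N ≤ M → partial T M n ≡ c

-- Let λ have λ_s = k, and let t be the number of rows below s with parts ≥ m. Removing the s × k
-- rectangle in the top left corner and the t × m rectangle below it leaves three independent pieces:
-- the rows above s minus k (a nonincreasing (s − 1)-tuple, generating function 1/(q;q)_{s−1}), the t
-- rows below s minus m (a partition in a t × (k − m) box, generating function [t + k − m, k − m]_q by
-- the q-Pascal recurrence), and the parts below m (generating function 1/(q;q)_{m−1}). Since
-- λ'_m = s + t, the hook h_{s,m} = k + t − m + 1 is h-fixed exactly when s = k − h − m + 1 + t, and
-- |λ| = s k + m t plus the sizes of the pieces. So the t-th summand of the first series counts the
-- partitions whose fixed hook gives this t; different t count disjoint sets, and only t ≤ n reach q^n.
-- The second series is termwise equal to the first.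

module Submission where

open import Defs
open import Data.Nat as ℕ using (ℕ; zero; suc; _∸_; _≤_; _<_; _≥_; z≤n; s≤s; _≤?_)
import Data.Nat.Properties as ℕ
open import Data.Integer as ℤ using (ℤ; +_; -[1+_])
import Data.Integer.Properties as ℤ
open import Data.Integer.Tactic.RingSolver using (solve-∀)
open import Data.Bool using (Bool; if_then_else_)
open import Data.Empty using (⊥; ⊥-elim)
open import Data.Product using (Σ; _×_; _,_; proj₁; proj₂)
open import Data.Sum as Sum using (_⊎_; inj₁; inj₂; [_,_]′)
open import Data.List using (List; []; _∷_; _++_; map; length; reverse; replicate; filter)
import Data.List.Properties as List
open import Data.List.Relation.Unary.All as All using (All; []; _∷_)
import Data.List.Relation.Unary.All.Properties as All
open import Data.List.Relation.Unary.AllPairs as AllPairs using (AllPairs; []; _∷_)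
import Data.List.Relation.Unary.AllPairs.Properties as AllPairs
open import Data.List.Relation.Unary.Unique.Propositional using (Unique)
import Data.List.Relation.Unary.Unique.Propositional.Properties as Unique
open import Data.List.Membership.Propositional using (_∈_)
open import Data.Nat.ListAction using (sum)
open import Data.Nat.ListAction.Properties using (sum-++)
open import Function using (_∘_; id; flip)
open import Function.Bundles using (_⇔_; mk⇔; Equivalence)
open import Relation.Binary.PropositionalEquality
open import Relation.Nullary using (¬_; yes; no; Dec)
open import Relation.Nullary.Decidable using (dec-true; dec-false)

module FiniteSums where
  open import Data.Integer using (_+_; _*_; -_)

  sumTo-cong : ∀ N {f g : ℕ → ℤ} → (∀ i → i < N → f i ≡ g i) → sumTo N f ≡ sumTo N g
  sumTo-cong zero    f≡g = refl
  sumTo-cong (suc N) f≡g = cong₂ _+_ (sumTo-cong N (λ i i<N → f≡g i (ℕ.m<n⇒m<1+n i<N))) (f≡g N ℕ.≤-refl)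

  sumTo-zero : ∀ N {f : ℕ → ℤ} → (∀ i → i < N → f i ≡ + 0) → sumTo N f ≡ + 0
  sumTo-zero zero    f≡0 = refl
  sumTo-zero (suc N) f≡0 = cong₂ _+_ (sumTo-zero N (λ i i<N → f≡0 i (ℕ.m<n⇒m<1+n i<N))) (f≡0 N ℕ.≤-refl)

  sumTo-+ : ∀ N (f g : ℕ → ℤ) → sumTo N (λ i → f i + g i) ≡ sumTo N f + sumTo N g
  sumTo-+ zero    f g = refl
  sumTo-+ (suc N) f g rewrite sumTo-+ N f g = medial (sumTo N f) (sumTo N g) (f N) (g N)
    where
    medial : ∀ a b c d → a + b + (c + d) ≡ a + c + (b + d)
    medial = solve-∀

  sumTo-*ˡ : ∀ N a (f : ℕ → ℤ) → sumTo N (λ i → a * f i) ≡ a * sumTo N f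
  sumTo-*ˡ zero    a f = sym (ℤ.*-zeroʳ a)
  sumTo-*ˡ (suc N) a f rewrite sumTo-*ˡ N a f = sym (ℤ.*-distribˡ-+ a (sumTo N f) (f N))

  sumTo-*ʳ : ∀ N a (f : ℕ → ℤ) → sumTo N (λ i → f i * a) ≡ sumTo N f * a
  sumTo-*ʳ zero    a f = refl
  sumTo-*ʳ (suc N) a f rewrite sumTo-*ʳ N a f = sym (ℤ.*-distribʳ-+ a (sumTo N f) (f N))

  sumTo-neg : ∀ N (f : ℕ → ℤ) → sumTo N (λ i → - f i) ≡ - sumTo N f
  sumTo-neg zero    f = refl
  sumTo-neg (suc N) f rewrite sumTo-neg N f = sym (ℤ.neg-distrib-+ (sumTo N f) (f N))

  sumTo-unfoldˡ : ∀ N (f : ℕ → ℤ) → sumTo (suc N) f ≡ f 0 + sumTo N (f ∘ suc)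
  sumTo-unfoldˡ zero    f = ℤ.+-comm (+ 0) (f 0)
  sumTo-unfoldˡ (suc N) f rewrite sumTo-unfoldˡ N f = ℤ.+-assoc (f 0) (sumTo N (f ∘ suc)) (f (suc N))

  sumTo-split : ∀ e N (f : ℕ → ℤ) → sumTo (e ℕ.+ N) f ≡ sumTo e f + sumTo N (λ i → f (e ℕ.+ i))
  sumTo-split e zero    f rewrite ℕ.+-identityʳ e = sym (ℤ.+-identityʳ (sumTo e f))
  sumTo-split e (suc N) f rewrite ℕ.+-suc e N | sumTo-split e N f =
    ℤ.+-assoc (sumTo e f) (sumTo N (λ i → f (e ℕ.+ i))) (f (e ℕ.+ N))

  sumTo-reverse : ∀ N (f : ℕ → ℤ) → sumTo N f ≡ sumTo N (λ i → f (N ∸ suc i))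
  sumTo-reverse zero    f = refl
  sumTo-reverse (suc N) f = begin
    sumTo N f + f N                      ≡⟨ cong (_+ f N) (sumTo-reverse N f) ⟩
    sumTo N (λ i → f (N ∸ suc i)) + f N  ≡⟨ ℤ.+-comm _ (f N) ⟩
    f N + sumTo N (λ i → f (N ∸ suc i))  ≡⟨ sumTo-unfoldˡ N (λ i → f (suc N ∸ suc i)) ⟨
    sumTo (suc N) (λ i → f (N ∸ i))      ∎
    where open ≡-Reasoning

  private
    suc-∸ : ∀ N j → j < suc N → suc N ∸ j ≡ suc (N ∸ j)
    suc-∸ N j (s≤s j≤N) = ℕ.+-∸-assoc 1 j≤N

  sumTo-triangle : ∀ N (g : ℕ → ℕ → ℤ) →
    sumTo N (λ i → sumTo (suc i) (g i)) ≡ sumTo N (λ j → sumTo (N ∸ j) (λ i → g (j ℕ.+ i) j))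
  sumTo-triangle zero    g = refl
  sumTo-triangle (suc N) g = begin
    sumTo N (λ i → sumTo (suc i) (g i)) + sumTo (suc N) (g N)  ≡⟨ cong (_+ sumTo (suc N) (g N)) (sumTo-triangle N g) ⟩
    sumTo N column + sumTo (suc N) (g N)                       ≡⟨ cong (λ z → z + sumTo (suc N) (g N)) last-column-empty ⟨
    sumTo (suc N) column + sumTo (suc N) (g N)                 ≡⟨ sumTo-+ (suc N) column (g N) ⟨
    sumTo (suc N) (λ j → column j + g N j)                     ≡⟨ sumTo-cong (suc N) extend ⟩
    sumTo (suc N) (λ j → sumTo (suc N ∸ j) (λ i → g (j ℕ.+ i) j)) ∎
    where
    open ≡-Reasoning
    column : ℕ → ℤ
    column j = sumTo (N ∸ j) (λ i → g (j ℕ.+ i) j)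
    last-column-empty : sumTo N column + column N ≡ sumTo N column
    last-column-empty rewrite ℕ.n∸n≡0 N = ℤ.+-identityʳ (sumTo N column)
    extend : ∀ j → j < suc N → column j + g N j ≡ sumTo (suc N ∸ j) (λ i → g (j ℕ.+ i) j)
    extend j j<sN rewrite suc-∸ N j j<sN | ℕ.m+[n∸m]≡n (ℕ.≤-pred j<sN) = refl

open FiniteSums

module PowerSeries where
  open import Data.Integer using (_+_; _*_; -_)
  open import Algebra.Bundles using (CommutativeMonoid)
  open import Algebra.Structures using (IsCommutativeMonoid)
  import Algebra.Properties.CommutativeSemigroup as CommSemigroupProperties

  infixl 6 _+ₛ_
  _+ₛ_ : Series → Series → Series
  (F +ₛ G) n = F n + G n

  -ₛ_ : Series → Series
  (-ₛ F) n = - F n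

  shiftℕ : ℕ → Series → Series
  shiftℕ e F n with e ≤? n
  ... | yes _ = F (n ∸ e)
  ... | no  _ = + 0

  shiftℕ-+ : ∀ e F i → shiftℕ e F (e ℕ.+ i) ≡ F i
  shiftℕ-+ e F i with e ≤? e ℕ.+ i
  ... | yes _  = cong F (ℕ.m+n∸m≡n e i)
  ... | no e≰ = ⊥-elim (e≰ (ℕ.m≤m+n e i))

  shiftℕ-< : ∀ e F n → n < e → shiftℕ e F n ≡ + 0
  shiftℕ-< e F n n<e with e ≤? n
  ... | yes e≤n = ⊥-elim (ℕ.<⇒≱ n<e e≤n)
  ... | no  _   = refl

  ≥-or-<-elim : ∀ e (P : ℕ → Set) → (∀ d → P (e ℕ.+ d)) → (∀ n → n < e → P n) → ∀ n → P n
  ≥-or-<-elim e P ≥e <e n with e ≤? n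
  ... | yes e≤n = subst P (ℕ.m+[n∸m]≡n e≤n) (≥e (n ∸ e))
  ... | no  e≰n = <e n (ℕ.≰⇒> e≰n)

  shiftℕ-cong : ∀ e {F G} → F ≗ G → shiftℕ e F ≗ shiftℕ e G
  shiftℕ-cong e F≗G n with e ≤? n
  ... | yes _ = F≗G (n ∸ e)
  ... | no  _ = refl

  shiftℕ-+ₛ : ∀ e F G → shiftℕ e (F +ₛ G) ≗ shiftℕ e F +ₛ shiftℕ e G
  shiftℕ-+ₛ e F G n with e ≤? n
  ... | yes _ = refl
  ... | no  _ = refl

  shiftℕ--ₛ : ∀ e F → shiftℕ e (-ₛ F) ≗ -ₛ shiftℕ e F
  shiftℕ--ₛ e F n with e ≤? n
  ... | yes _ = refl
  ... | no  _ = refl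

  shiftℕ-shiftℕ : ∀ a b F → shiftℕ a (shiftℕ b F) ≗ shiftℕ (a ℕ.+ b) F
  shiftℕ-shiftℕ a b F = ≥-or-<-elim (a ℕ.+ b) _ ≥a+b <a+b
    where
    ≥a+b : ∀ d → shiftℕ a (shiftℕ b F) (a ℕ.+ b ℕ.+ d) ≡ shiftℕ (a ℕ.+ b) F (a ℕ.+ b ℕ.+ d)
    ≥a+b d rewrite ℕ.+-assoc a b d | shiftℕ-+ a (shiftℕ b F) (b ℕ.+ d) | shiftℕ-+ b F d
                 | sym (ℕ.+-assoc a b d) | shiftℕ-+ (a ℕ.+ b) F d = refl
    <a+b : ∀ n → n < a ℕ.+ b → shiftℕ a (shiftℕ b F) n ≡ shiftℕ (a ℕ.+ b) F n
    <a+b n n<a+b rewrite shiftℕ-< (a ℕ.+ b) F n n<a+b =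
      ≥-or-<-elim a (λ n → n < a ℕ.+ b → shiftℕ a (shiftℕ b F) n ≡ + 0)
        (λ d a+d<a+b → trans (shiftℕ-+ a _ d) (shiftℕ-< b F d (ℕ.+-cancelˡ-< a d b a+d<a+b)))
        (λ n n<a _ → shiftℕ-< a _ n n<a) n n<a+b

  ⊛-cong : ∀ {F F′ G G′} → F ≗ F′ → G ≗ G′ → F ⊛ G ≗ F′ ⊛ G′
  ⊛-cong F≗F′ G≗G′ n = sumTo-cong (suc n) (λ i _ → cong₂ _*_ (F≗F′ i) (G≗G′ (n ∸ i)))

  ⊛-comm : ∀ F G → F ⊛ G ≗ G ⊛ F
  ⊛-comm F G n = trans (sumTo-reverse (suc n) _) (sumTo-cong (suc n) swap)
    where
    swap : ∀ i → i < suc n → F (n ∸ i) * G (n ∸ (n ∸ i)) ≡ G i * F (n ∸ i)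
    swap i (s≤s i≤n) rewrite ℕ.m∸[m∸n]≡n i≤n = ℤ.*-comm (F (n ∸ i)) (G i)

  ⊛-assoc : ∀ F G H → (F ⊛ G) ⊛ H ≗ F ⊛ (G ⊛ H)
  ⊛-assoc F G H n = begin
    sumTo (suc n) (λ i → sumTo (suc i) (λ j → F j * G (i ∸ j)) * H (n ∸ i))
      ≡⟨ sumTo-cong (suc n) (λ i _ → sumTo-*ʳ (suc i) (H (n ∸ i)) (λ j → F j * G (i ∸ j))) ⟨
    sumTo (suc n) (λ i → sumTo (suc i) (g i))
      ≡⟨ sumTo-triangle (suc n) g ⟩
    sumTo (suc n) (λ j → sumTo (suc n ∸ j) (λ i → g (j ℕ.+ i) j))
      ≡⟨ sumTo-cong (suc n) inner ⟩
    sumTo (suc n) (λ j → F j * sumTo (suc (n ∸ j)) (λ l → G l * H (n ∸ j ∸ l))) ∎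
    where
    open ≡-Reasoning
    g : ℕ → ℕ → ℤ
    g i j = F j * G (i ∸ j) * H (n ∸ i)
    inner : ∀ j → j < suc n → sumTo (suc n ∸ j) (λ i → g (j ℕ.+ i) j)
                             ≡ F j * sumTo (suc (n ∸ j)) (λ l → G l * H (n ∸ j ∸ l))
    inner j (s≤s j≤n) rewrite ℕ.+-∸-assoc 1 j≤n =
      trans (sumTo-cong (suc (n ∸ j)) (λ i _ →
               trans (cong₂ (λ a b → F j * G a * H b) (ℕ.m+n∸m≡n j i) (sym (ℕ.∸-+-assoc n j i)))
                     (ℤ.*-assoc (F j) (G i) (H (n ∸ j ∸ i)))))
            (sumTo-*ˡ (suc (n ∸ j)) (F j) (λ l → G l * H (n ∸ j ∸ l)))

  ⊛-identityˡ : ∀ F → oneS ⊛ F ≗ F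
  ⊛-identityˡ F n = begin
    sumTo (suc n) (λ i → oneS i * F (n ∸ i))        ≡⟨ sumTo-unfoldˡ n _ ⟩
    + 1 * F n + sumTo n (λ i → + 0 * F (n ∸ suc i))  ≡⟨ cong₂ _+_ (ℤ.*-identityˡ (F n)) (sumTo-zero n (λ i _ → refl)) ⟩
    F n + + 0                                         ≡⟨ ℤ.+-identityʳ (F n) ⟩
    F n                                               ∎
    where open ≡-Reasoning

  ⊛-identityʳ : ∀ F → F ⊛ oneS ≗ F
  ⊛-identityʳ F n = trans (⊛-comm F oneS n) (⊛-identityˡ F n)

  ⊛-isCommutativeMonoid : IsCommutativeMonoid _≗_ _⊛_ oneS
  ⊛-isCommutativeMonoid = record
    { isMonoid = record
      { isSemigroup = record
        { isMagma = record
          { isEquivalence = Setoid.isEquivalence (ℕ →-setoid ℤ)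
          ; ∙-cong = ⊛-cong }
        ; assoc = ⊛-assoc }
      ; identity = ⊛-identityˡ , ⊛-identityʳ }
    ; comm = ⊛-comm }
    where open import Relation.Binary.Bundles using (Setoid)

  ⊛-commutativeMonoid : CommutativeMonoid _ _
  ⊛-commutativeMonoid = record { isCommutativeMonoid = ⊛-isCommutativeMonoid }

  open CommutativeMonoid ⊛-commutativeMonoid public
    using () renaming (setoid to ≗-setoid; refl to ≗-refl; sym to ≗-sym)
  open CommSemigroupProperties (CommutativeMonoid.commutativeSemigroup ⊛-commutativeMonoid) public
    using (interchange; xy∙z≈xz∙y)

  ⊛-zeroˡ : ∀ G → zeroS ⊛ G ≗ zeroS
  ⊛-zeroˡ G n = sumTo-zero (suc n) (λ i _ → refl)

  ⊛-distribˡ : ∀ F G H → F ⊛ (G +ₛ H) ≗ F ⊛ G +ₛ F ⊛ H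
  ⊛-distribˡ F G H n =
    trans (sumTo-cong (suc n) (λ i _ → ℤ.*-distribˡ-+ (F i) (G (n ∸ i)) (H (n ∸ i)))) (sumTo-+ (suc n) _ _)

  ⊛-distribʳ : ∀ F G H → (F +ₛ G) ⊛ H ≗ F ⊛ H +ₛ G ⊛ H
  ⊛-distribʳ F G H n = trans (⊛-comm (F +ₛ G) H n)
    (trans (⊛-distribˡ H F G n) (cong₂ _+_ (⊛-comm H F n) (⊛-comm H G n)))

  ⊛-negʳ : ∀ F G → F ⊛ (-ₛ G) ≗ -ₛ (F ⊛ G)
  ⊛-negʳ F G n =
    trans (sumTo-cong (suc n) (λ i _ → sym (ℤ.neg-distribʳ-* (F i) (G (n ∸ i))))) (sumTo-neg (suc n) _)

  ⊛-negˡ : ∀ F G → (-ₛ F) ⊛ G ≗ -ₛ (F ⊛ G)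
  ⊛-negˡ F G n = trans (⊛-comm (-ₛ F) G n) (trans (⊛-negʳ G F n) (cong -_ (⊛-comm G F n)))

  +ₛ-cong : ∀ {F F′ G G′} → F ≗ F′ → G ≗ G′ → F +ₛ G ≗ F′ +ₛ G′
  +ₛ-cong F≗F′ G≗G′ n = cong₂ _+_ (F≗F′ n) (G≗G′ n)

  ⊛-shiftℕˡ : ∀ e F G → shiftℕ e F ⊛ G ≗ shiftℕ e (F ⊛ G)
  ⊛-shiftℕˡ e F G = ≥-or-<-elim e _ ≥e <e
    where
    ≥e : ∀ d → (shiftℕ e F ⊛ G) (e ℕ.+ d) ≡ shiftℕ e (F ⊛ G) (e ℕ.+ d)
    ≥e d = begin
      sumTo (suc (e ℕ.+ d)) (λ i → shiftℕ e F i * G (e ℕ.+ d ∸ i))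
        ≡⟨ cong (λ w → sumTo w (λ i → shiftℕ e F i * G (e ℕ.+ d ∸ i))) (ℕ.+-suc e d) ⟨
      sumTo (e ℕ.+ suc d) (λ i → shiftℕ e F i * G (e ℕ.+ d ∸ i))
        ≡⟨ sumTo-split e (suc d) _ ⟩
      sumTo e (λ i → shiftℕ e F i * G (e ℕ.+ d ∸ i))
        + sumTo (suc d) (λ i → shiftℕ e F (e ℕ.+ i) * G (e ℕ.+ d ∸ (e ℕ.+ i)))
        ≡⟨ cong₂ _+_ (sumTo-zero e (λ i i<e → cong (_* G (e ℕ.+ d ∸ i)) (shiftℕ-< e F i i<e)))
                     (sumTo-cong (suc d) (λ i _ → cong₂ _*_ (shiftℕ-+ e F i) (cong G (ℕ.[m+n]∸[m+o]≡n∸o e d i)))) ⟩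
      + 0 + (F ⊛ G) d         ≡⟨ ℤ.+-identityˡ ((F ⊛ G) d) ⟩
      (F ⊛ G) d               ≡⟨ shiftℕ-+ e (F ⊛ G) d ⟨
      shiftℕ e (F ⊛ G) (e ℕ.+ d) ∎
      where open ≡-Reasoning
    <e : ∀ n → n < e → (shiftℕ e F ⊛ G) n ≡ shiftℕ e (F ⊛ G) n
    <e n n<e = trans (sumTo-zero (suc n) (λ i i<1+n →
                        cong (_* G (n ∸ i)) (shiftℕ-< e F i (ℕ.≤-<-trans (ℕ.≤-pred i<1+n) n<e))))
                     (sym (shiftℕ-< e (F ⊛ G) n n<e))

  ⊛-shiftℕʳ : ∀ e F G → F ⊛ shiftℕ e G ≗ shiftℕ e (F ⊛ G)
  ⊛-shiftℕʳ e F G n =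
    trans (⊛-comm F (shiftℕ e G) n) (trans (⊛-shiftℕˡ e G F n) (shiftℕ-cong e (⊛-comm G F) n))

  private
    ⊖-<⇒≢+ : ∀ {n e d} → n < e → n ℤ.⊖ e ≢ + d
    ⊖-<⇒≢+ {n} {e} n<e eq with e ∸ n in e∸n≡ | trans (sym (ℤ.⊖-< n<e)) eq
    ... | zero  | _  = ℕ.m>n⇒m∸n≢0 n<e e∸n≡
    ... | suc _ | ()

  shift-+≗shiftℕ : ∀ e F → shift (+ e) F ≗ shiftℕ e F
  shift-+≗shiftℕ e F n with (+ n) ℤ.- (+ e) in n-e≡ | e ≤? n
  ... | + d      | yes e≤n = cong F (ℤ.+-injective (trans (sym n-e≡) (trans (ℤ.m-n≡m⊖n n e) (ℤ.⊖-≥ e≤n))))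
  ... | -[1+ _ ] | yes e≤n with () ← trans (sym n-e≡) (trans (ℤ.m-n≡m⊖n n e) (ℤ.⊖-≥ e≤n))
  ... | + d      | no  e≰n = ⊥-elim (⊖-<⇒≢+ (ℕ.≰⇒> e≰n) (trans (sym (ℤ.m-n≡m⊖n n e)) n-e≡))
  ... | -[1+ _ ] | no  _   = refl

  shift-zeroS : ∀ E {F} → F ≗ zeroS → shift E F ≗ zeroS
  shift-zeroS E F≗0 n with (+ n) ℤ.- E
  ... | + d      = F≗0 d
  ... | -[1+ _ ] = refl

open PowerSeries

module QSeries where
  open import Data.Integer using (_+_; -_)
  open import Data.Nat.Divisibility using (_∣_; _∣?_; ∣m+n∣m⇒∣n; ∣m∣n⇒∣m+n; ∣-refl; _∣0; ∣⇒≤)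
  open import Relation.Binary.Reasoning.Setoid ≗-setoid

  geom-unfold : ∀ c → geom (suc c) ≗ oneS +ₛ shiftℕ (suc c) (geom (suc c))
  geom-unfold c = ≥-or-<-elim (suc c) _ ≥c <c
    where
    indicator : Bool → ℤ
    indicator b = if b then + 1 else + 0
    ≥c : ∀ d → geom (suc c) (suc c ℕ.+ d) ≡ oneS (suc c ℕ.+ d) + shiftℕ (suc c) (geom (suc c)) (suc c ℕ.+ d)
    ≥c d rewrite shiftℕ-+ (suc c) (geom (suc c)) d =
      trans (periodic (suc c ∣? d)) (sym (ℤ.+-identityˡ (geom (suc c) d)))
      where
      periodic : Dec (suc c ∣ d) → geom (suc c) (suc c ℕ.+ d) ≡ geom (suc c) d
      periodic (yes c∣d) = trans (cong indicator (dec-true (suc c ∣? _) (∣m∣n⇒∣m+n ∣-refl c∣d)))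
                                 (sym (cong indicator (dec-true (suc c ∣? d) c∣d)))
      periodic (no c∤d)  = trans (cong indicator (dec-false (suc c ∣? _) (λ c∣c+d → c∤d (∣m+n∣m⇒∣n c∣c+d ∣-refl))))
                                 (sym (cong indicator (dec-false (suc c ∣? d) c∤d)))
    <c : ∀ n → n < suc c → geom (suc c) n ≡ oneS n + shiftℕ (suc c) (geom (suc c)) n
    <c n n<c rewrite shiftℕ-< (suc c) (geom (suc c)) n n<c = below n n<c
      where
      below : ∀ n → n < suc c → geom (suc c) n ≡ oneS n + + 0
      below zero    _     = cong indicator (dec-true (suc c ∣? 0) (suc c ∣0))
      below (suc n) n<c   = cong indicator (dec-false (suc c ∣? suc n) (λ c∣n → ℕ.<⇒≱ n<c (∣⇒≤ c∣n)))

  oneMinusQ-unfold : ∀ c → oneMinusQ (suc c) ≗ oneS +ₛ -ₛ shiftℕ (suc c) oneS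
  oneMinusQ-unfold c = ≥-or-<-elim (suc c) _ ≥c <c
    where
    minusIf : Bool → ℤ
    minusIf b = if b then - (+ 1) else + 0
    ≥c : ∀ d → oneMinusQ (suc c) (suc c ℕ.+ d) ≡ oneS (suc c ℕ.+ d) + (-ₛ shiftℕ (suc c) oneS) (suc c ℕ.+ d)
    ≥c zero rewrite shiftℕ-+ (suc c) oneS 0 | ℕ.+-identityʳ c =
      cong minusIf (dec-true (suc c ℕ.≟ suc c) refl)
    ≥c (suc d) rewrite shiftℕ-+ (suc c) oneS (suc d) =
      cong minusIf (dec-false (suc c ℕ.+ suc d ℕ.≟ suc c) (λ eq → ℕ.m≢1+m+n (suc c) (trans (sym eq) (ℕ.+-suc (suc c) d))))
    <c : ∀ n → n < suc c → oneMinusQ (suc c) n ≡ oneS n + (-ₛ shiftℕ (suc c) oneS) n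
    <c n n<c rewrite shiftℕ-< (suc c) oneS n n<c = below n n<c
      where
      below : ∀ n → n < suc c → oneMinusQ (suc c) n ≡ oneS n + - (+ 0)
      below zero    _   = refl
      below (suc n) n<c = cong minusIf (dec-false (suc n ℕ.≟ suc c) (ℕ.<⇒≢ n<c))

  oneMinusQ⊛geom : ∀ c → oneMinusQ (suc c) ⊛ geom (suc c) ≗ oneS
  oneMinusQ⊛geom c = begin
    oneMinusQ (suc c) ⊛ G                       ≈⟨ ⊛-cong (oneMinusQ-unfold c) (≗-refl {G}) ⟩
    (oneS +ₛ -ₛ shiftℕ (suc c) oneS) ⊛ G        ≈⟨ ⊛-distribʳ oneS (-ₛ shiftℕ (suc c) oneS) G ⟩
    oneS ⊛ G +ₛ (-ₛ shiftℕ (suc c) oneS) ⊛ G    ≈⟨ +ₛ-cong (⊛-identityˡ G) shifted ⟩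
    G +ₛ -ₛ shiftℕ (suc c) G                    ≈⟨ telescope ⟩
    oneS                                         ∎
    where
    G = geom (suc c)
    shifted : (-ₛ shiftℕ (suc c) oneS) ⊛ G ≗ -ₛ shiftℕ (suc c) G
    shifted n = trans (⊛-negˡ (shiftℕ (suc c) oneS) G n)
                      (cong -_ (trans (⊛-shiftℕˡ (suc c) oneS G n) (shiftℕ-cong (suc c) (⊛-identityˡ G) n)))
    telescope : G +ₛ -ₛ shiftℕ (suc c) G ≗ oneS
    telescope n rewrite geom-unfold c n = cancel (oneS n) (shiftℕ (suc c) G n)
      where
      cancel : ∀ a b → a + b + - b ≡ a
      cancel = solve-∀

  poch⊛invPoch : ∀ a → poch a ⊛ invPoch a ≗ oneS
  poch⊛invPoch zero    = ⊛-identityˡ oneS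
  poch⊛invPoch (suc a) = begin
    (poch a ⊛ oneMinusQ (suc a)) ⊛ (invPoch a ⊛ geom (suc a))
      ≈⟨ interchange (poch a) (oneMinusQ (suc a)) (invPoch a) (geom (suc a)) ⟩
    (poch a ⊛ invPoch a) ⊛ (oneMinusQ (suc a) ⊛ geom (suc a))
      ≈⟨ ⊛-cong (poch⊛invPoch a) (oneMinusQ⊛geom a) ⟩
    oneS ⊛ oneS
      ≈⟨ ⊛-identityˡ oneS ⟩
    oneS ∎

  invPoch-unfold : ∀ a → invPoch (suc a) ≗ invPoch a +ₛ shiftℕ (suc a) (invPoch (suc a))
  invPoch-unfold a = begin
    invPoch a ⊛ geom (suc a)
      ≈⟨ ⊛-cong (≗-refl {invPoch a}) (geom-unfold a) ⟩
    invPoch a ⊛ (oneS +ₛ shiftℕ (suc a) (geom (suc a)))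
      ≈⟨ ⊛-distribˡ (invPoch a) oneS (shiftℕ (suc a) (geom (suc a))) ⟩
    invPoch a ⊛ oneS +ₛ invPoch a ⊛ shiftℕ (suc a) (geom (suc a))
      ≈⟨ +ₛ-cong (⊛-identityʳ (invPoch a)) (⊛-shiftℕʳ (suc a) (invPoch a) (geom (suc a))) ⟩
    invPoch a +ₛ shiftℕ (suc a) (invPoch a ⊛ geom (suc a)) ∎

  -- Partitions in a t × j box, by the q-Pascal recurrence (split on whether the largest part is j).
  box : ℕ → ℕ → Series
  box zero    j       = oneS
  box (suc t) zero    = oneS
  box (suc t) (suc j) = box (suc t) j +ₛ shiftℕ (suc j) (box t (suc j))

  oneMinusQ-+ : ∀ j t → oneMinusQ (suc j) +ₛ shiftℕ (suc j) (oneMinusQ (suc t)) ≗ oneMinusQ (suc j ℕ.+ suc t)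
  oneMinusQ-+ j t = begin
    oneMinusQ 1+j +ₛ shiftℕ 1+j (oneMinusQ 1+t)
      ≈⟨ +ₛ-cong (oneMinusQ-unfold j) (shiftℕ-cong 1+j (oneMinusQ-unfold t)) ⟩
    (oneS +ₛ -ₛ shiftℕ 1+j oneS) +ₛ shiftℕ 1+j (oneS +ₛ -ₛ shiftℕ 1+t oneS)
      ≈⟨ +ₛ-cong (≗-refl {oneS +ₛ -ₛ shiftℕ 1+j oneS}) distribute ⟩
    (oneS +ₛ -ₛ shiftℕ 1+j oneS) +ₛ (shiftℕ 1+j oneS +ₛ -ₛ shiftℕ (1+j ℕ.+ 1+t) oneS)
      ≈⟨ (λ n → telescope (oneS n) (shiftℕ 1+j oneS n) (shiftℕ (1+j ℕ.+ 1+t) oneS n)) ⟩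
    oneS +ₛ -ₛ shiftℕ (1+j ℕ.+ 1+t) oneS
      ≈⟨ ≗-sym (oneMinusQ-unfold (j ℕ.+ suc t)) ⟩
    oneMinusQ (1+j ℕ.+ 1+t) ∎
    where
    1+j = suc j
    1+t = suc t
    distribute : shiftℕ 1+j (oneS +ₛ -ₛ shiftℕ 1+t oneS) ≗ shiftℕ 1+j oneS +ₛ -ₛ shiftℕ (1+j ℕ.+ 1+t) oneS
    distribute n = trans (shiftℕ-+ₛ 1+j oneS (-ₛ shiftℕ 1+t oneS) n)
      (cong (λ x → shiftℕ 1+j oneS n + x)
            (trans (shiftℕ--ₛ 1+j (shiftℕ 1+t oneS) n) (cong -_ (shiftℕ-shiftℕ 1+j 1+t oneS n))))
    telescope : ∀ a b c → a + - b + (b + - c) ≡ a + - c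
    telescope = solve-∀

  box⊛poch⊛poch : ∀ t j → box t j ⊛ poch j ⊛ poch t ≗ poch (t ℕ.+ j)
  box⊛poch⊛poch zero    j n = trans (⊛-identityʳ (oneS ⊛ poch j) n) (⊛-identityˡ (poch j) n)
  box⊛poch⊛poch (suc t) zero n =
    trans (⊛-cong (⊛-identityˡ oneS) (≗-refl {poch (suc t)}) n)
          (trans (⊛-identityˡ (poch (suc t)) n) (cong (λ w → poch w n) (sym (ℕ.+-identityʳ (suc t)))))
  box⊛poch⊛poch (suc t) (suc j) = begin
    (box 1+t j +ₛ shiftℕ 1+j (box t 1+j)) ⊛ poch 1+j ⊛ poch 1+t
      ≈⟨ ⊛-cong (⊛-distribʳ (box 1+t j) (shiftℕ 1+j (box t 1+j)) (poch 1+j)) (≗-refl {poch 1+t}) ⟩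
    (box 1+t j ⊛ poch 1+j +ₛ shiftℕ 1+j (box t 1+j) ⊛ poch 1+j) ⊛ poch 1+t
      ≈⟨ ⊛-distribʳ (box 1+t j ⊛ poch 1+j) (shiftℕ 1+j (box t 1+j) ⊛ poch 1+j) (poch 1+t) ⟩
    box 1+t j ⊛ poch 1+j ⊛ poch 1+t +ₛ shiftℕ 1+j (box t 1+j) ⊛ poch 1+j ⊛ poch 1+t
      ≈⟨ +ₛ-cong first second ⟩
    P ⊛ oneMinusQ 1+j +ₛ P ⊛ shiftℕ 1+j (oneMinusQ 1+t)
      ≈⟨ ≗-sym (⊛-distribˡ P (oneMinusQ 1+j) (shiftℕ 1+j (oneMinusQ 1+t))) ⟩
    P ⊛ (oneMinusQ 1+j +ₛ shiftℕ 1+j (oneMinusQ 1+t))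
      ≈⟨ ⊛-cong (≗-refl {P}) (oneMinusQ-+ j t) ⟩
    P ⊛ oneMinusQ (1+j ℕ.+ 1+t)
      ≈⟨ (λ n → cong (λ w → (P ⊛ oneMinusQ (suc w)) n) (trans (ℕ.+-suc j t) (cong suc (ℕ.+-comm j t)))) ⟩
    poch (suc (suc (t ℕ.+ j)))
      ≈⟨ (λ n → cong (λ w → poch (suc w) n) (sym (ℕ.+-suc t j))) ⟩
    poch (1+t ℕ.+ 1+j) ∎
    where
    1+t = suc t
    1+j = suc j
    P = poch (suc (t ℕ.+ j))
    first : box 1+t j ⊛ poch 1+j ⊛ poch 1+t ≗ P ⊛ oneMinusQ 1+j
    first = begin
      box 1+t j ⊛ (poch j ⊛ oneMinusQ 1+j) ⊛ poch 1+t
        ≈⟨ ⊛-cong (≗-sym (⊛-assoc (box 1+t j) (poch j) (oneMinusQ 1+j))) (≗-refl {poch 1+t}) ⟩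
      box 1+t j ⊛ poch j ⊛ oneMinusQ 1+j ⊛ poch 1+t
        ≈⟨ xy∙z≈xz∙y (box 1+t j ⊛ poch j) (oneMinusQ 1+j) (poch 1+t) ⟩
      box 1+t j ⊛ poch j ⊛ poch 1+t ⊛ oneMinusQ 1+j
        ≈⟨ ⊛-cong (box⊛poch⊛poch (suc t) j) (≗-refl {oneMinusQ 1+j}) ⟩
      P ⊛ oneMinusQ 1+j ∎
    second : shiftℕ 1+j (box t 1+j) ⊛ poch 1+j ⊛ poch 1+t ≗ P ⊛ shiftℕ 1+j (oneMinusQ 1+t)
    second = begin
      shiftℕ 1+j (box t 1+j) ⊛ poch 1+j ⊛ poch 1+t
        ≈⟨ ⊛-cong (⊛-shiftℕˡ 1+j (box t 1+j) (poch 1+j)) (≗-refl {poch 1+t}) ⟩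
      shiftℕ 1+j (box t 1+j ⊛ poch 1+j) ⊛ poch 1+t
        ≈⟨ ⊛-shiftℕˡ 1+j (box t 1+j ⊛ poch 1+j) (poch 1+t) ⟩
      shiftℕ 1+j (box t 1+j ⊛ poch 1+j ⊛ (poch t ⊛ oneMinusQ 1+t))
        ≈⟨ shiftℕ-cong 1+j (≗-sym (⊛-assoc (box t 1+j ⊛ poch 1+j) (poch t) (oneMinusQ 1+t))) ⟩
      shiftℕ 1+j (box t 1+j ⊛ poch 1+j ⊛ poch t ⊛ oneMinusQ 1+t)
        ≈⟨ shiftℕ-cong 1+j (⊛-cong (box⊛poch⊛poch t (suc j)) (≗-refl {oneMinusQ 1+t})) ⟩
      shiftℕ 1+j (poch (t ℕ.+ 1+j) ⊛ oneMinusQ 1+t)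
        ≈⟨ shiftℕ-cong 1+j (λ n → cong (λ w → (poch w ⊛ oneMinusQ 1+t) n) (ℕ.+-suc t j)) ⟩
      shiftℕ 1+j (P ⊛ oneMinusQ 1+t)
        ≈⟨ ≗-sym (⊛-shiftℕʳ 1+j P (oneMinusQ 1+t)) ⟩
      P ⊛ shiftℕ 1+j (oneMinusQ 1+t) ∎

  gauss≗box : ∀ t j → gauss (+ (t ℕ.+ j)) (+ j) ≗ box t j
  gauss≗box t j n rewrite dec-true (j ≤? t ℕ.+ j) (ℕ.m≤n+m j t) | ℕ.m+n∸n≡m t j = cancel n
    where
    B = box t j
    cancel : poch (t ℕ.+ j) ⊛ invPoch j ⊛ invPoch t ≗ B
    cancel = begin
      poch (t ℕ.+ j) ⊛ invPoch j ⊛ invPoch t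
        ≈⟨ ⊛-cong (⊛-cong (≗-sym (box⊛poch⊛poch t j)) (≗-refl {invPoch j})) (≗-refl {invPoch t}) ⟩
      B ⊛ poch j ⊛ poch t ⊛ invPoch j ⊛ invPoch t
        ≈⟨ ⊛-cong (xy∙z≈xz∙y (B ⊛ poch j) (poch t) (invPoch j)) (≗-refl {invPoch t}) ⟩
      B ⊛ poch j ⊛ invPoch j ⊛ poch t ⊛ invPoch t
        ≈⟨ ⊛-assoc (B ⊛ poch j ⊛ invPoch j) (poch t) (invPoch t) ⟩
      B ⊛ poch j ⊛ invPoch j ⊛ (poch t ⊛ invPoch t)
        ≈⟨ ⊛-cong (⊛-assoc B (poch j) (invPoch j)) (poch⊛invPoch t) ⟩
      B ⊛ (poch j ⊛ invPoch j) ⊛ oneS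
        ≈⟨ ⊛-identityʳ (B ⊛ (poch j ⊛ invPoch j)) ⟩
      B ⊛ (poch j ⊛ invPoch j)
        ≈⟨ ⊛-cong (≗-refl {B}) (poch⊛invPoch j) ⟩
      B ⊛ oneS
        ≈⟨ ⊛-identityʳ B ⟩
      B ∎

open QSeries

module Counting where
  open import Data.Integer using (_+_; _*_)
  open import Data.List using (cartesianProduct)
  open import Data.List.Membership.Propositional.Properties
    using (∈-++⁺ˡ; ∈-++⁺ʳ; ∈-++⁻; ∈-map⁺; ∈-map⁻; ∈-cartesianProduct⁺; ∈-cartesianProduct⁻)
  open import Data.List.Membership.Propositional.Properties.WithK using (unique∧set⇒bag)
  open import Data.List.Relation.Binary.BagAndSetEquality using (∼bag⇒↭)
  open import Data.List.Relation.Binary.Permutation.Propositional.Properties using (↭-length)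
  open import Data.List.Relation.Unary.Any using (here; there)

  record Count {A : Set} (P : A → Set) (c : ℕ) : Set where
    field
      elements : List A
      unique   : Unique elements
      sound    : ∀ {x} → x ∈ elements → P x
      complete : ∀ {x} → P x → x ∈ elements
      length≡  : length elements ≡ c
  open Count

  Image : {A B : Set} → (A → B) → (A → Set) → B → Set
  Image f P y = Σ _ λ x → P x × f x ≡ y

  count-unique : ∀ {A : Set} {P : A → Set} {a b} → Count P a → Count P b → a ≡ b
  count-unique C D = begin
    _                    ≡⟨ length≡ C ⟨
    length (elements C)  ≡⟨ ↭-length (∼bag⇒↭ (unique∧set⇒bag (unique C) (unique D) same)) ⟩
    length (elements D)  ≡⟨ length≡ D ⟩
    _                    ∎
    where
    open ≡-Reasoning
    same : ∀ {x} → x ∈ elements C ⇔ x ∈ elements D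
    same = mk⇔ (complete D ∘ sound C) (complete C ∘ sound D)

  module _ {A : Set} {P Q : A → Set} where

    count-⇔ : ∀ {c} → (∀ {x} → P x → Q x) → (∀ {x} → Q x → P x) → Count P c → Count Q c
    count-⇔ P⇒Q Q⇒P C = record
      { elements = elements C ; unique = unique C ; sound = P⇒Q ∘ sound C
      ; complete = complete C ∘ Q⇒P ; length≡ = length≡ C }

    count-⊎ : ∀ {a b} → Count P a → Count Q b → (∀ {x} → P x → Q x → ⊥) →
              Count (λ x → P x ⊎ Q x) (a ℕ.+ b)
    count-⊎ C D disjoint = record
      { elements = elements C ++ elements D
      ; unique   = Unique.++⁺ (unique C) (unique D) (λ (∈C , ∈D) → disjoint (sound C ∈C) (sound D ∈D))
      ; sound    = Sum.map (sound C) (sound D) ∘ ∈-++⁻ (elements C)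
      ; complete = [ ∈-++⁺ˡ ∘ complete C , ∈-++⁺ʳ (elements C) ∘ complete D ]′
      ; length≡  = trans (List.length-++ (elements C)) (cong₂ ℕ._+_ (length≡ C) (length≡ D)) }

  count-∅ : ∀ {A : Set} {P : A → Set} → (∀ {x} → ¬ P x) → Count P 0
  count-∅ ¬P = record { elements = [] ; unique = [] ; sound = λ () ; complete = ⊥-elim ∘ ¬P ; length≡ = refl }

  unique-map⁺ : ∀ {A B : Set} (f : A → B) {xs} → (∀ {x y} → x ∈ xs → y ∈ xs → f x ≡ f y → x ≡ y) →
                Unique xs → Unique (map f xs)
  unique-map⁺ f {[]}     _   []         = []
  unique-map⁺ f {x ∷ xs} inj (x∉ ∷ xs!) =
    All.map⁺ (All.tabulate λ y∈ fx≡fy → All.lookup x∉ y∈ (inj (here refl) (there y∈) fx≡fy))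
    ∷ unique-map⁺ f (λ x∈ y∈ → inj (there x∈) (there y∈)) xs!

  count-image : ∀ {A B : Set} {P : A → Set} {c} (f : A → B) → (∀ {x y} → P x → P y → f x ≡ f y → x ≡ y) →
                Count P c → Count (Image f P) c
  count-image f inj C = record
    { elements = map f (elements C)
    ; unique   = unique-map⁺ f (λ x∈ y∈ → inj (sound C x∈) (sound C y∈)) (unique C)
    ; sound    = λ y∈ → let (x , x∈ , y≡fx) = ∈-map⁻ f y∈ in x , sound C x∈ , sym y≡fx
    ; complete = λ { (x , px , refl) → ∈-map⁺ f (complete C px) }
    ; length≡  = trans (List.length-map f (elements C)) (length≡ C) }

  length-cartesianProduct : ∀ {A B : Set} (xs : List A) (ys : List B) →
                            length (cartesianProduct xs ys) ≡ length xs ℕ.* length ys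
  length-cartesianProduct []       ys = refl
  length-cartesianProduct (x ∷ xs) ys =
    trans (List.length-++ (map (x ,_) ys)) (cong₂ ℕ._+_ (List.length-map (x ,_) ys) (length-cartesianProduct xs ys))

  count-× : ∀ {A B : Set} {P : A → Set} {Q : B → Set} {a b} → Count P a → Count Q b →
            Count (λ (p : A × B) → P (proj₁ p) × Q (proj₂ p)) (a ℕ.* b)
  count-× C D = record
    { elements = cartesianProduct (elements C) (elements D)
    ; unique   = Unique.cartesianProduct⁺ (unique C) (unique D)
    ; sound    = λ p∈ → let (x∈ , y∈) = ∈-cartesianProduct⁻ (elements C) (elements D) p∈ in sound C x∈ , sound D y∈
    ; complete = λ (px , qy) → ∈-cartesianProduct⁺ (complete C px) (complete D qy)
    ; length≡  = trans (length-cartesianProduct (elements C) (elements D)) (cong₂ ℕ._*_ (length≡ C) (length≡ D)) }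

  Countℤ : {A : Set} → (A → Set) → ℤ → Set
  Countℤ P z = Σ ℕ λ c → Count P c × + c ≡ z

  countℤ-value : ∀ {A : Set} {P : A → Set} {c z} → Count P c → Countℤ P z → z ≡ + c
  countℤ-value C (c′ , C′ , c′≡z) = trans (sym c′≡z) (cong +_ (count-unique C′ C))

  countℤ-⇔ : ∀ {A : Set} {P Q : A → Set} {z} →
             (∀ {x} → P x → Q x) → (∀ {x} → Q x → P x) → Countℤ P z → Countℤ Q z
  countℤ-⇔ P⇒Q Q⇒P (c , C , c≡z) = c , count-⇔ P⇒Q Q⇒P C , c≡z

  countℤ-∅ : ∀ {A : Set} {P : A → Set} → (∀ {x} → ¬ P x) → Countℤ P (+ 0)
  countℤ-∅ ¬P = 0 , count-∅ ¬P , refl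

  countℤ-× : ∀ {A B : Set} {P : A → Set} {Q : B → Set} {a b} → Countℤ P a → Countℤ Q b →
             Countℤ (λ (p : A × B) → P (proj₁ p) × Q (proj₂ p)) (a * b)
  countℤ-× (a , C , refl) (b , D , refl) = a ℕ.* b , count-× C D , ℤ.pos-* a b

  countℤ-Σ< : ∀ {A : Set} {R : ℕ → A → Set} N (g : ℕ → ℤ) →
              (∀ i → i < N → Countℤ (R i) (g i)) → (∀ {i i′ x} → R i x → R i′ x → i ≡ i′) →
              Countℤ (λ x → Σ ℕ λ i → i < N × R i x) (sumTo N g)
  countℤ-Σ< zero g _ _ = countℤ-∅ (λ { (_ , () , _) })
  countℤ-Σ< {R = R} (suc N) g C R-functional
    with countℤ-Σ< {R = R} N g (λ i i<N → C i (ℕ.m<n⇒m<1+n i<N)) R-functional | C N ℕ.≤-refl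
  ... | a , below , a≡ | b , at , b≡ =
    a ℕ.+ b , count-⇔ join split (count-⊎ below at (λ (i , i<N , r) r′ → ℕ.<-irrefl (R-functional r r′) i<N)) ,
    cong₂ _+_ a≡ b≡
    where
    join : ∀ {x} → (Σ ℕ λ i → i < N × R i x) ⊎ R N x → Σ ℕ λ i → i < suc N × R i x
    join (inj₁ (i , i<N , r)) = i , ℕ.m<n⇒m<1+n i<N , r
    join (inj₂ r)             = N , ℕ.≤-refl , r
    split : ∀ {x} → (Σ ℕ λ i → i < suc N × R i x) → (Σ ℕ λ i → i < N × R i x) ⊎ R N x
    split (i , s≤s i≤N , r) with ℕ.m≤n⇒m<n∨m≡n i≤N
    ... | inj₁ i<N  = inj₁ (i , i<N , r)
    ... | inj₂ refl = inj₂ r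

open Counting

module GeneratingFunctions where
  open import Data.Integer using (_+_; _*_)
  open import Data.List.Relation.Unary.Any using (here)
  open import Data.Nat.Induction using (<-rec)

  Generates : {A : Set} → (A → Set) → (A → ℕ) → Series → Set
  Generates P w F = ∀ n → Countℤ (λ x → P x × w x ≡ n) (F n)

  generates-oneS : ∀ {A : Set} {Q : A → Set} (w : A → ℕ) {x₀} →
                   (∀ {x} → Q x → x ≡ x₀) → Q x₀ → w x₀ ≡ 0 → Generates Q w oneS
  generates-oneS {Q = Q} w {x₀} only q₀ w≡0 zero = 1 , single , refl
    where
    single : Count (λ x → Q x × w x ≡ 0) 1
    single = record
      { elements = x₀ ∷ [] ; unique = [] ∷ [] ; sound = λ { (here refl) → q₀ , w≡0 }
      ; complete = λ (q , _) → here (only q) ; length≡ = refl }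
  generates-oneS w only _ w≡0 (suc n) =
    countℤ-∅ (λ (q , w≡1+n) → ℕ.0≢1+n (trans (sym w≡0) (trans (cong w (sym (only q))) w≡1+n)))

  generates-⊛ : ∀ {A B : Set} {P : A → Set} {Q : B → Set} {w v F G} → Generates P w F → Generates Q v G →
                Generates (λ (p : A × B) → P (proj₁ p) × Q (proj₂ p))
                          (λ p → w (proj₁ p) ℕ.+ v (proj₂ p)) (F ⊛ G)
  generates-⊛ {A} {B} {P} {Q} {w} {v} {F} {G} genP genQ n =
    countℤ-⇔ join split (countℤ-Σ< {R = R} (suc n) (λ i → F i * G (n ∸ i))
      (λ i _ → countℤ-× (genP i) (genQ (n ∸ i))) (λ ((_ , w≡i) , _) ((_ , w≡i′) , _) → trans (sym w≡i) w≡i′))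
    where
    R : ℕ → A × B → Set
    R i p = (P (proj₁ p) × w (proj₁ p) ≡ i) × (Q (proj₂ p) × v (proj₂ p) ≡ n ∸ i)
    join : ∀ {p} → Σ ℕ (λ i → i < suc n × R i p) → (P (proj₁ p) × Q (proj₂ p)) × w (proj₁ p) ℕ.+ v (proj₂ p) ≡ n
    join (i , s≤s i≤n , (px , refl) , (qy , v≡n∸i)) = (px , qy) , trans (cong (w _ ℕ.+_) v≡n∸i) (ℕ.m+[n∸m]≡n i≤n)
    split : ∀ {p} → (P (proj₁ p) × Q (proj₂ p)) × w (proj₁ p) ℕ.+ v (proj₂ p) ≡ n → Σ ℕ (λ i → i < suc n × R i p)
    split {x , y} ((px , qy) , refl) = w x , s≤s (ℕ.m≤m+n (w x) (v y)) , (px , refl) , (qy , sym (ℕ.m+n∸m≡n (w x) (v y)))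

  module _ {A B : Set} (v : A → ℕ) (w : B → ℕ) {Q : A → Set} {G : Series} (c : ℕ) (g : A → B)
           (g-injective : ∀ {x y} → Q x → Q y → g x ≡ g y → x ≡ y)
           (weight-g : ∀ {y} → Q y → w (g y) ≡ c ℕ.+ v y) where

    countℤ-shiftℕ : ∀ n → (∀ d → c ℕ.+ d ≡ n → Countℤ (λ y → Q y × v y ≡ d) (G d)) →
                    Countℤ (λ x → Image g Q x × w x ≡ n) (shiftℕ c G n)
    countℤ-shiftℕ = ≥-or-<-elim c _ ≥c <c
      where
      ≥c : ∀ d → (∀ d′ → c ℕ.+ d′ ≡ c ℕ.+ d → Countℤ (λ y → Q y × v y ≡ d′) (G d′)) →
           Countℤ (λ x → Image g Q x × w x ≡ c ℕ.+ d) (shiftℕ c G (c ℕ.+ d))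
      ≥c d countQ with countQ d refl
      ... | k , CQ , k≡ =
        k , count-⇔ join split (count-image g (λ (qx , _) (qy , _) → g-injective qx qy) CQ) , trans k≡ (sym (shiftℕ-+ c G d))
        where
        join : ∀ {x} → Image g (λ y → Q y × v y ≡ d) x → Image g Q x × w x ≡ c ℕ.+ d
        join (y , (qy , refl) , refl) = (y , qy , refl) , weight-g qy
        split : ∀ {x} → Image g Q x × w x ≡ c ℕ.+ d → Image g (λ y → Q y × v y ≡ d) x
        split ((y , qy , refl) , w≡c+d) = y , (qy , ℕ.+-cancelˡ-≡ c _ _ (trans (sym (weight-g qy)) w≡c+d)) , refl
      <c : ∀ n → n < c → (∀ d → c ℕ.+ d ≡ n → Countℤ (λ y → Q y × v y ≡ d) (G d)) →
           Countℤ (λ x → Image g Q x × w x ≡ n) (shiftℕ c G n)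
      <c n n<c _ = subst (Countℤ _) (sym (shiftℕ-< c G n n<c)) (countℤ-∅ too-heavy)
        where
        too-heavy : ∀ {x} → ¬ (Image g Q x × w x ≡ n)
        too-heavy ((y , qy , refl) , w≡n) =
          ℕ.<⇒≱ n<c (subst (c ≤_) (trans (sym (weight-g qy)) w≡n) (ℕ.m≤m+n c (v y)))

  module _ {A : Set} (w : A → ℕ) {P Q : A → Set} {F G : Series} (c : ℕ) (g : A → A)
           (g-injective : ∀ {x y} → Q x → Q y → g x ≡ g y → x ≡ y)
           (weight-g : ∀ {y} → Q y → w (g y) ≡ c ℕ.+ w y)
           (g-disjoint : ∀ {x y} → P x → Q y → g y ≢ x) where

    countℤ-+ₛ-shiftℕ : ∀ n → Countℤ (λ x → P x × w x ≡ n) (F n) →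
      (∀ d → c ℕ.+ d ≡ n → Countℤ (λ y → Q y × w y ≡ d) (G d)) →
      Countℤ (λ x → (P x ⊎ Image g Q x) × w x ≡ n) ((F +ₛ shiftℕ c G) n)
    countℤ-+ₛ-shiftℕ n (a , CP , a≡) countQ with countℤ-shiftℕ w w c g g-injective weight-g n countQ
    ... | b , CS , b≡ =
      a ℕ.+ b , count-⇔ join split (count-⊎ CP CS (λ (px , _) ((_ , qy , gy≡x) , _) → g-disjoint px qy gy≡x)) ,
      cong₂ _+_ a≡ b≡
      where
      join : ∀ {x} → (P x × w x ≡ n) ⊎ (Image g Q x × w x ≡ n) → (P x ⊎ Image g Q x) × w x ≡ n
      join (inj₁ (px , w≡n)) = inj₁ px , w≡n
      join (inj₂ (qx , w≡n)) = inj₂ qx , w≡n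
      split : ∀ {x} → (P x ⊎ Image g Q x) × w x ≡ n → (P x × w x ≡ n) ⊎ (Image g Q x × w x ≡ n)
      split (inj₁ px , w≡n) = inj₁ (px , w≡n)
      split (inj₂ qx , w≡n) = inj₂ (qx , w≡n)

  countℤ-image : ∀ {A : Set} {w : A → ℕ} {P : A → Set} (f : A → A) → (∀ {x y} → f x ≡ f y → x ≡ y) →
                 (∀ {x} → P x → w (f x) ≡ w x) →
                 ∀ {n z} → Countℤ (λ x → P x × w x ≡ n) z → Countℤ (λ x → Image f P x × w x ≡ n) z
  countℤ-image f f-injective weight-f (c , C , c≡) =
    c , count-⇔ join split (count-image f (λ _ _ → f-injective) C) , c≡
    where
    join : ∀ {n x} → Image f (λ x → _ × _ ≡ n) x → Image f _ x × _ ≡ n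
    join (x , (px , refl) , refl) = (x , px , refl) , weight-f px
    split : ∀ {n x} → Image f _ x × _ ≡ n → Image f (λ x → _ × _ ≡ n) x
    split ((x , px , refl) , w≡n) = x , (px , trans (sym (weight-f px)) w≡n) , refl

  module InvPochRecursion {A : Set} (w : A → ℕ) (P : ℕ → A → Set) (f g : ℕ → A → A)
    (base : Generates (P 0) w oneS)
    (f-injective : ∀ a {x y} → f a x ≡ f a y → x ≡ y)
    (g-injective : ∀ a {x y} → g a x ≡ g a y → x ≡ y)
    (weight-f : ∀ a {x} → P a x → w (f a x) ≡ w x)
    (weight-g : ∀ a {y} → P (suc a) y → w (g a y) ≡ suc a ℕ.+ w y)
    (f-g-disjoint : ∀ a {x y} → P a x → P (suc a) y → g a y ≢ f a x)
    (split : ∀ a {x} → P (suc a) x → Image (f a) (P a) x ⊎ Image (g a) (P (suc a)) x)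
    (merge : ∀ a {x} → Image (f a) (P a) x ⊎ Image (g a) (P (suc a)) x → P (suc a) x) where

    generates-invPoch : ∀ a → Generates (P a) w (invPoch a)
    generates-invPoch a n = <-rec Goal level n a
      where
      Goal : ℕ → Set
      Goal n = ∀ a → Countℤ (λ x → P a x × w x ≡ n) (invPoch a n)
      level : ∀ n → (∀ {d} → d < n → Goal d) → Goal n
      level n _       zero    = base n
      level n smaller (suc a) =
        subst (Countℤ _) (sym (invPoch-unfold a n))
          (countℤ-⇔ (λ (u , w≡n) → merge a u , w≡n) (λ (p , w≡n) → split a p , w≡n)
            (countℤ-+ₛ-shiftℕ w {F = invPoch a} {G = invPoch (suc a)} (suc a) (g a) (λ _ _ → g-injective a) (weight-g a)
               (λ { (_ , px , refl) py → f-g-disjoint a px py }) n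
               (countℤ-image (f a) (f-injective a) (weight-f a) (level n smaller a))
               (λ d a+d≡n → smaller (subst (d <_) a+d≡n (s≤s (ℕ.m≤n+m d a))) (suc a))))

open GeneratingFunctions

module ListLemmas where
  open import Data.List.Relation.Binary.Permutation.Propositional.Properties using (↭-reverse)
  open import Data.Nat.ListAction.Properties using (sum-↭)
  open import Data.Unit using (tt)

  map-+-∸ : ∀ c {xs} → All (c ≤_) xs → map (c ℕ.+_) (map (_∸ c) xs) ≡ xs
  map-+-∸ c []         = refl
  map-+-∸ c (c≤x ∷ c≤) = cong₂ _∷_ (ℕ.m+[n∸m]≡n c≤x) (map-+-∸ c c≤)

  sum-map-+ : ∀ c xs → sum (map (c ℕ.+_) xs) ≡ length xs ℕ.* c ℕ.+ sum xs
  sum-map-+ c []       = refl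
  sum-map-+ c (x ∷ xs) rewrite sum-map-+ c xs = shuffle c x (length xs) (sum xs)
    where
    import Data.Nat.Tactic.RingSolver as ℕ-Solver
    shuffle : ∀ c x l s → c ℕ.+ x ℕ.+ (l ℕ.* c ℕ.+ s) ≡ c ℕ.+ l ℕ.* c ℕ.+ (x ℕ.+ s)
    shuffle = ℕ-Solver.solve-∀

  All-map-+ : ∀ c {P : ℕ → Set} {xs} → (∀ x → P (c ℕ.+ x)) → All P (map (c ℕ.+_) xs)
  All-map-+ c {xs = xs} P+ = All.map⁺ (All.tabulate {xs = xs} (λ {x} _ → P+ x))

  AllPairs-map-+ : ∀ c {xs} → AllPairs _≥_ xs → AllPairs _≥_ (map (c ℕ.+_) xs)
  AllPairs-map-+ c = AllPairs.map⁺ ∘ AllPairs.map (ℕ.+-monoʳ-≤ c)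

  AllPairs-map-∸ : ∀ {R : ℕ → ℕ → Set} c → (∀ {x y} → R x y → R (x ∸ c) (y ∸ c)) →
                   ∀ {xs} → AllPairs R xs → AllPairs R (map (_∸ c) xs)
  AllPairs-map-∸ c mono = AllPairs.map⁺ ∘ AllPairs.map mono

  length-map-+ : ∀ c {xs ys} → length xs ≡ length ys → length (map (c ℕ.+_) xs) ≡ length (map (c ℕ.+_) ys)
  length-map-+ c {xs} {ys} len = trans (List.length-map _ xs) (trans len (sym (List.length-map _ ys)))

  All-reverse : ∀ {P : ℕ → Set} {xs} → All P xs → All P (reverse xs)
  All-reverse P = All.tabulate (All.lookup P ∘ Any.reverse⁻)
    where import Data.List.Relation.Unary.Any.Properties as Any

  AllPairs-reverse : ∀ {R : ℕ → ℕ → Set} {xs} → AllPairs R xs → AllPairs (flip R) (reverse xs)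
  AllPairs-reverse {xs = []}     []       = []
  AllPairs-reverse {xs = x ∷ xs} (Rx ∷ R) rewrite List.unfold-reverse x xs =
    AllPairs.++⁺ (AllPairs-reverse R) ([] ∷ []) (All-reverse (All.map (_∷ []) Rx))

  sum-reverse : ∀ xs → sum (reverse xs) ≡ sum xs
  sum-reverse xs = sum-↭ (↭-reverse xs)

  AllPairs-++⁻ : ∀ {R : ℕ → ℕ → Set} xs {ys} → AllPairs R (xs ++ ys) →
                 AllPairs R xs × AllPairs R ys × All (λ x → All (R x) ys) xs
  AllPairs-++⁻ []       Rys          = [] , Rys , []
  AllPairs-++⁻ (x ∷ xs) (Rx ∷ Rxs++ys) with AllPairs-++⁻ xs Rxs++ys
  ... | Rxs , Rys , Rxs-ys = All.++⁻ˡ xs Rx ∷ Rxs , Rys , All.++⁻ʳ xs Rx ∷ Rxs-ys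

  ++-injective : ∀ {xs xs′ ys ys′ : List ℕ} → length xs ≡ length xs′ →
                 xs ++ ys ≡ xs′ ++ ys′ → xs ≡ xs′ × ys ≡ ys′
  ++-injective {[]}     {[]}       _   eq = refl , eq
  ++-injective {x ∷ xs} {x′ ∷ xs′} len eq with List.∷-injective eq
  ... | refl , eq′ with ++-injective {xs} {xs′} (ℕ.suc-injective len) eq′
  ... | refl , eq″ = refl , eq″

  span-≥ : ∀ c R → AllPairs _≥_ R → Σ (List ℕ) λ B → Σ (List ℕ) λ Z → R ≡ B ++ Z × All (c ≤_) B × All (_< c) Z
  span-≥ c []      _          = [] , [] , refl , [] , []
  span-≥ c (x ∷ R) (x≥ ∷ desc) with c ≤? x
  ... | yes c≤x = let (B , Z , R≡ , c≤B , Z<c) = span-≥ c R desc in x ∷ B , Z , cong (x ∷_) R≡ , c≤x ∷ c≤B , Z<c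
  ... | no  c≰x = [] , x ∷ R , refl , [] , x<c ∷ All.map (λ y≤x → ℕ.≤-<-trans y≤x x<c) x≥
    where x<c = ℕ.≰⇒> c≰x

  nonincreasing⇒AllPairs : ∀ {xs} → Nonincreasing xs → AllPairs _≥_ xs
  nonincreasing⇒AllPairs {[]}         _           = []
  nonincreasing⇒AllPairs {x ∷ []}     _           = [] ∷ []
  nonincreasing⇒AllPairs {x ∷ y ∷ xs} (y≤x , rest) with nonincreasing⇒AllPairs {y ∷ xs} rest
  ... | y≥ ∷ desc = (y≤x ∷ All.map (λ z≤y → ℕ.≤-trans z≤y y≤x) y≥) ∷ y≥ ∷ desc

  AllPairs⇒nonincreasing : ∀ {xs} → AllPairs _≥_ xs → Nonincreasing xs
  AllPairs⇒nonincreasing {[]}         _                = tt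
  AllPairs⇒nonincreasing {x ∷ []}     _                = tt
  AllPairs⇒nonincreasing {x ∷ y ∷ xs} ((y≤x ∷ _) ∷ desc) = y≤x , AllPairs⇒nonincreasing desc

  part-++ : ∀ xs c ys → part (xs ++ c ∷ ys) (suc (length xs)) ≡ c
  part-++ []       c ys = refl
  part-++ (x ∷ xs) c ys = part-++ xs c ys

  conj-++ : ∀ xs ys c → conj (xs ++ ys) c ≡ conj xs c ℕ.+ conj ys c
  conj-++ xs ys c rewrite List.filter-++ (c ≤?_) xs ys = List.length-++ (filter (c ≤?_) xs)

  conj-all : ∀ {xs} c → All (c ≤_) xs → conj xs c ≡ length xs
  conj-all c c≤ = cong length (List.filter-all (c ≤?_) c≤)

  conj-none : ∀ {xs} c → All (_< c) xs → conj xs c ≡ 0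
  conj-none c <c = cong length (List.filter-none (c ≤?_) (All.map ℕ.<⇒≱ <c))

open ListLemmas

module ListFamilies where

  NondecreasingOfLength : ℕ → List ℕ → Set
  NondecreasingOfLength a xs = AllPairs _≤_ xs × length xs ≡ a

  NonincreasingOfLength : ℕ → List ℕ → Set
  NonincreasingOfLength a xs = AllPairs _≥_ xs × length xs ≡ a

  PartitionWithPartsAtMost : ℕ → List ℕ → Set
  PartitionWithPartsAtMost a zs = AllPairs _≥_ zs × All (1 ≤_) zs × All (_≤ a) zs

  InBox : ℕ → ℕ → List ℕ → Set
  InBox t j ys = NonincreasingOfLength t ys × All (_≤ j) ys

  module NondecreasingLists where

    split : ∀ a {x} → NondecreasingOfLength (suc a) x →
            Image (0 ∷_) (NondecreasingOfLength a) x ⊎ Image (map suc) (NondecreasingOfLength (suc a)) x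
    split a {zero  ∷ xs} (_ ∷ asc , refl)  = inj₁ (xs , (asc , refl) , refl)
    split a {suc x ∷ xs} (x≤ ∷ asc , refl) =
      inj₂ (map (_∸ 1) (suc x ∷ xs) ,
            (AllPairs-map-∸ 1 (ℕ.∸-monoˡ-≤ 1) (x≤ ∷ asc) , List.length-map (_∸ 1) (suc x ∷ xs)) ,
            map-+-∸ 1 (s≤s z≤n ∷ All.map (ℕ.≤-trans (s≤s z≤n)) x≤))

    merge : ∀ a {x} → Image (0 ∷_) (NondecreasingOfLength a) x ⊎ Image (map suc) (NondecreasingOfLength (suc a)) x →
            NondecreasingOfLength (suc a) x
    merge a (inj₁ (y , (asc , refl) , refl)) = All.tabulate (λ _ → z≤n) ∷ asc , refl
    merge a (inj₂ (y , (asc , y-length) , refl)) =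
      AllPairs.map⁺ (AllPairs.map s≤s asc) , trans (List.length-map suc y) y-length

    weight-suc : ∀ a {y} → NondecreasingOfLength (suc a) y → sum (map suc y) ≡ suc a ℕ.+ sum y
    weight-suc a {y} (_ , y-length) =
      trans (sum-map-+ 1 y) (cong (ℕ._+ sum y) (trans (ℕ.*-identityʳ (length y)) y-length))

    disjoint : ∀ a {x y} → NondecreasingOfLength a x → NondecreasingOfLength (suc a) y → map suc y ≢ 0 ∷ x
    disjoint a {y = _ ∷ _} _ _ ()

    base : Generates (NondecreasingOfLength 0) sum oneS
    base = generates-oneS sum (λ { {[]} _ → refl ; {_ ∷ _} (_ , ()) }) ([] , refl) refl

    open InvPochRecursion sum NondecreasingOfLength (λ _ → 0 ∷_) (λ _ → map suc) base (λ _ → List.∷-injectiveʳ)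
      (λ _ → List.map-injective ℕ.suc-injective) (λ _ _ → refl) weight-suc disjoint split merge public

  generates-nonincreasingOfLength : ∀ a → Generates (NonincreasingOfLength a) sum (invPoch a)
  generates-nonincreasingOfLength a n =
    countℤ-⇔ join split (countℤ-image reverse List.reverse-injective (λ {x} _ → sum-reverse x)
                           (NondecreasingLists.generates-invPoch a n))
    where
    join : ∀ {x} → Image reverse (NondecreasingOfLength a) x × sum x ≡ n → NonincreasingOfLength a x × sum x ≡ n
    join ((y , (asc , y-length) , refl) , w≡n) = (AllPairs-reverse asc , trans (List.length-reverse y) y-length) , w≡n
    split : ∀ {x} → NonincreasingOfLength a x × sum x ≡ n → Image reverse (NondecreasingOfLength a) x × sum x ≡ n
    split {x} ((desc , x-length) , w≡n) =
      (reverse x , (AllPairs-reverse desc , trans (List.length-reverse x) x-length) , List.reverse-involutive x) , w≡n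

  module PartitionsWithBoundedParts where

    split : ∀ a {x} → PartitionWithPartsAtMost (suc a) x →
            Image id (PartitionWithPartsAtMost a) x ⊎ Image (suc a ∷_) (PartitionWithPartsAtMost (suc a)) x
    split a {[]}     _ = inj₁ ([] , ([] , [] , []) , refl)
    split a {x ∷ xs} (x≥ ∷ desc , 1≤x ∷ 1≤ , x≤1+a ∷ ≤1+a) with ℕ.m≤n⇒m<n∨m≡n x≤1+a
    ... | inj₂ refl     = inj₂ (xs , (desc , 1≤ , ≤1+a) , refl)
    ... | inj₁ (s≤s x≤a) =
      inj₁ (x ∷ xs , (x≥ ∷ desc , 1≤x ∷ 1≤ , x≤a ∷ All.map (λ y≤x → ℕ.≤-trans y≤x x≤a) x≥) , refl)

    merge : ∀ a {x} → Image id (PartitionWithPartsAtMost a) x ⊎ Image (suc a ∷_) (PartitionWithPartsAtMost (suc a)) x →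
            PartitionWithPartsAtMost (suc a) x
    merge a (inj₁ (_ , (desc , 1≤ , ≤a) , refl))   = desc , 1≤ , All.map ℕ.m≤n⇒m≤1+n ≤a
    merge a (inj₂ (_ , (desc , 1≤ , ≤1+a) , refl)) = ≤1+a ∷ desc , s≤s z≤n ∷ 1≤ , ℕ.≤-refl ∷ ≤1+a

    disjoint : ∀ a {x y} → PartitionWithPartsAtMost a x → PartitionWithPartsAtMost (suc a) y → suc a ∷ y ≢ x
    disjoint a (_ , _ , 1+a≤a ∷ _) _ refl = ℕ.<-irrefl refl 1+a≤a

    base : Generates (PartitionWithPartsAtMost 0) sum oneS
    base = generates-oneS sum empty ([] , [] , []) refl
      where
      empty : ∀ {x} → PartitionWithPartsAtMost 0 x → x ≡ []
      empty {[]}    _                      = refl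
      empty {_ ∷ _} (_ , s≤s _ ∷ _ , () ∷ _)

    open InvPochRecursion sum PartitionWithPartsAtMost (λ _ → id) (λ a → suc a ∷_) base (λ _ x≡y → x≡y)
      (λ _ → List.∷-injectiveʳ) (λ _ _ → refl) (λ _ _ → refl) disjoint split merge public

  generates-partitionWithPartsAtMost : ∀ a → Generates (PartitionWithPartsAtMost a) sum (invPoch a)
  generates-partitionWithPartsAtMost = PartitionsWithBoundedParts.generates-invPoch

  generates-box : ∀ t j → Generates (InBox t j) sum (box t j)
  generates-box zero    j       = generates-oneS sum (λ { {[]} _ → refl ; {_ ∷ _} ((_ , ()) , _) }) (([] , refl) , []) refl
  generates-box (suc t) zero    = generates-oneS sum zeros (zeros-InBox (suc t)) (sum-zeros (suc t))
    where
    zeros : ∀ {x} → InBox (suc t) 0 x → x ≡ replicate (suc t) 0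
    zeros {x} ((_ , x-length) , ≤0) = trans (all-zero ≤0) (cong (λ l → replicate l 0) x-length)
      where
      all-zero : ∀ {x} → All (_≤ 0) x → x ≡ replicate (length x) 0
      all-zero []         = refl
      all-zero (z≤n ∷ ≤0) = cong (0 ∷_) (all-zero ≤0)
    zeros-InBox : ∀ t → InBox t 0 (replicate t 0)
    zeros-InBox zero    = ([] , refl) , []
    zeros-InBox (suc t) =
      let ((desc , len) , ≤0) = zeros-InBox t in (All.replicate⁺ t z≤n ∷ desc , cong suc len) , z≤n ∷ ≤0
    sum-zeros : ∀ t → sum (replicate t 0) ≡ 0
    sum-zeros zero    = refl
    sum-zeros (suc t) = sum-zeros t
  generates-box (suc t) (suc j) n =
    countℤ-⇔ merge split
      (countℤ-+ₛ-shiftℕ sum {F = box (suc t) j} {G = box t (suc j)} (suc j) (suc j ∷_) (λ _ _ → List.∷-injectiveʳ)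
         (λ _ → refl) disjoint n (generates-box (suc t) j n) (λ d _ → generates-box t (suc j) d))
    where
    disjoint : ∀ {x y} → InBox (suc t) j x → InBox t (suc j) y → suc j ∷ y ≢ x
    disjoint (_ , 1+j≤j ∷ _) _ refl = ℕ.<-irrefl refl 1+j≤j
    merge : ∀ {x} → (InBox (suc t) j x ⊎ Image (suc j ∷_) (InBox t (suc j)) x) × sum x ≡ n →
            InBox (suc t) (suc j) x × sum x ≡ n
    merge (inj₁ (desc , ≤j) , w≡n)                         = (desc , All.map ℕ.m≤n⇒m≤1+n ≤j) , w≡n
    merge (inj₂ (_ , ((desc , refl) , ≤1+j) , refl) , w≡n) = ((≤1+j ∷ desc , refl) , ℕ.≤-refl ∷ ≤1+j) , w≡n
    split : ∀ {x} → InBox (suc t) (suc j) x × sum x ≡ n →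
            (InBox (suc t) j x ⊎ Image (suc j ∷_) (InBox t (suc j)) x) × sum x ≡ n
    split {x ∷ xs} (((x≥ ∷ desc , len) , x≤1+j ∷ ≤1+j) , w≡n) with ℕ.m≤n⇒m<n∨m≡n x≤1+j
    ... | inj₂ refl      = inj₂ (xs , ((desc , ℕ.suc-injective len) , ≤1+j) , refl) , w≡n
    ... | inj₁ (s≤s x≤j) = inj₁ ((x≥ ∷ desc , len) , x≤j ∷ All.map (λ y≤x → ℕ.≤-trans y≤x x≤j) x≥) , w≡n

open ListFamilies

module RowDecomposition (m′ j : ℕ) where

  m k : ℕ
  m = suc m′
  k = m ℕ.+ j

  Pieces : Set
  Pieces = (List ℕ × List ℕ) × List ℕ

  -- For a partition λ with λ_s = k (s = a + 1): X lists λ_i − k over the rows above s,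
  -- Y lists λ_i − m over the rows below s with λ_i ≥ m, and Z the parts below m.
  IsPieces : ℕ → ℕ → Pieces → Set
  IsPieces a t p =
    (NonincreasingOfLength a (proj₁ (proj₁ p)) × PartitionWithPartsAtMost m′ (proj₂ (proj₁ p))) × InBox t j (proj₂ p)

  size : Pieces → ℕ
  size p = (sum (proj₁ (proj₁ p)) ℕ.+ sum (proj₂ (proj₁ p))) ℕ.+ sum (proj₂ p)

  assemble : Pieces → List ℕ
  assemble ((X , Z) , Y) = map (k ℕ.+_) X ++ k ∷ (map (m ℕ.+_) Y ++ Z)

  baseSize : ℕ → ℕ → ℕ
  baseSize a t = suc a ℕ.* k ℕ.+ m ℕ.* t

  sum-assemble : ∀ {a t} p → IsPieces a t p → sum (assemble p) ≡ baseSize a t ℕ.+ size p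
  sum-assemble ((X , Z) , Y) (((_ , refl) , _) , ((_ , refl) , _))
    rewrite sum-++ (map (k ℕ.+_) X) (k ∷ (map (m ℕ.+_) Y ++ Z)) | sum-++ (map (m ℕ.+_) Y) Z
          | sum-map-+ k X | sum-map-+ m Y = regroup (length X) k (sum X) (length Y) m (sum Y) (sum Z)
    where
    import Data.Nat.Tactic.RingSolver as ℕ-Solver
    regroup : ∀ a k sx t m sy sz →
              a ℕ.* k ℕ.+ sx ℕ.+ (k ℕ.+ (t ℕ.* m ℕ.+ sy ℕ.+ sz))
              ≡ (k ℕ.+ a ℕ.* k ℕ.+ m ℕ.* t) ℕ.+ ((sx ℕ.+ sz) ℕ.+ sy)
    regroup = ℕ-Solver.solve-∀

  conj-assemble : ∀ {a t} p → IsPieces a t p → conj (assemble p) m ≡ suc a ℕ.+ t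
  conj-assemble ((X , Z) , Y) (((_ , refl) , (_ , _ , Z≤m′)) , ((_ , refl) , _))
    rewrite conj-++ (map (k ℕ.+_) X) (k ∷ (map (m ℕ.+_) Y ++ Z)) m
          | List.filter-accept (m ≤?_) {k} {map (m ℕ.+_) Y ++ Z} (ℕ.m≤m+n m j)
          | conj-++ (map (m ℕ.+_) Y) Z m
          | conj-all m (All-map-+ k {xs = X} (λ x → ℕ.≤-trans (ℕ.m≤m+n m j) (ℕ.m≤m+n k x)))
          | conj-all m (All-map-+ m {xs = Y} (ℕ.m≤m+n m))
          | conj-none m (All.map s≤s Z≤m′)
          | List.length-map (k ℕ.+_) X | List.length-map (m ℕ.+_) Y
          = trans (ℕ.+-suc (length X) _) (cong suc (cong (length X ℕ.+_) (ℕ.+-identityʳ (length Y))))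

  part-assemble : ∀ {a t} p → IsPieces a t p → part (assemble p) (suc a) ≡ k
  part-assemble ((X , Z) , Y) (((_ , refl) , _) , _) =
    trans (cong (λ l → part (assemble ((X , Z) , Y)) (suc l)) (sym (List.length-map (k ℕ.+_) X)))
          (part-++ (map (k ℕ.+_) X) k _)

  assemble-isPartition : ∀ {a t} p → IsPieces a t p → IsPartitionOf (baseSize a t ℕ.+ size p) (assemble p)
  assemble-isPartition p@((X , Z) , Y) pieces@(((descX , _) , (descZ , 1≤Z , Z≤m′)) , ((descY , _) , Y≤j)) =
    AllPairs⇒nonincreasing descending , positive , sum-assemble p pieces
    where
    below : List ℕ
    below = map (m ℕ.+_) Y ++ Z
    Z≤ : ∀ {c} → m ≤ c → All (_≤ c) Z
    Z≤ m≤c = All.map (λ z≤m′ → ℕ.≤-trans (ℕ.m≤n⇒m≤1+n z≤m′) m≤c) Z≤m′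
    below≤k : All (_≤ k) below
    below≤k = All.++⁺ (All.map⁺ (All.map (ℕ.+-monoʳ-≤ m) Y≤j)) (Z≤ (ℕ.m≤m+n m j))
    descending : AllPairs _≥_ (assemble p)
    descending = AllPairs.++⁺ (AllPairs-map-+ k descX)
      (below≤k ∷ AllPairs.++⁺ (AllPairs-map-+ m descY) descZ (All-map-+ m (λ y → Z≤ (ℕ.m≤m+n m y))))
      (All-map-+ k (λ x → All.map (λ y≤k → ℕ.≤-trans y≤k (ℕ.m≤m+n k x)) (ℕ.≤-refl ∷ below≤k)))
    positive : All (1 ≤_) (assemble p)
    positive = All.++⁺ (All-map-+ k (λ _ → s≤s z≤n)) (s≤s z≤n ∷ All.++⁺ (All-map-+ m (λ _ → s≤s z≤n)) 1≤Z)

  assemble-injective : ∀ {a t} p p′ → IsPieces a t p → IsPieces a t p′ → assemble p ≡ assemble p′ → p ≡ p′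
  assemble-injective ((X , Z) , Y) ((X′ , Z′) , Y′)
                     (((_ , lenX) , _) , ((_ , lenY) , _)) (((_ , lenX′) , _) , ((_ , lenY′) , _)) eq
    with ++-injective {map (k ℕ.+_) X} {map (k ℕ.+_) X′} (length-map-+ k {X} {X′} (trans lenX (sym lenX′))) eq
  ... | X≡ , eq′ with ++-injective {map (m ℕ.+_) Y} {map (m ℕ.+_) Y′}
                        (length-map-+ m {Y} {Y′} (trans lenY (sym lenY′))) (List.∷-injectiveʳ eq′)
  ... | Y≡ , refl rewrite List.map-injective (ℕ.+-cancelˡ-≡ k _ _) X≡ | List.map-injective (ℕ.+-cancelˡ-≡ m _ _) Y≡ = refl

  split-at-row : ∀ a (λs : List ℕ) → part λs (suc a) ≡ k →
                 Σ (List ℕ) λ A → Σ (List ℕ) λ R → λs ≡ A ++ k ∷ R × length A ≡ a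
  split-at-row a       []       eq   = ⊥-elim (ℕ.0≢1+n eq)
  split-at-row zero    (x ∷ xs) refl = [] , xs , refl , refl
  split-at-row (suc a) (x ∷ xs) eq with split-at-row a xs eq
  ... | A , R , refl , refl = x ∷ A , R , refl , refl

  decompose : ∀ {n λs} a → IsPartitionOf n λs → part λs (suc a) ≡ k →
              Σ ℕ λ t → Σ Pieces λ p → IsPieces a t p × assemble p ≡ λs
  decompose {λs = λs} a (noninc , positive , _) row-a+1≡k with split-at-row a λs row-a+1≡k
  ... | A , R , refl , lenA with AllPairs-++⁻ A (nonincreasing⇒AllPairs noninc)
  ... | descA , (k≥R ∷ descR) , A≥ with span-≥ m R descR
  ... | B , Z , refl , m≤B , Z<m with AllPairs-++⁻ B descR | All.++⁻ʳ A positive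
  ... | descB , descZ , _ | _ ∷ positiveR =
    length B , ((map (_∸ k) A , Z) , map (_∸ m) B) ,
    (((AllPairs-map-∸ k (ℕ.∸-monoˡ-≤ k) descA , trans (List.length-map _ A) lenA) ,
      (descZ , All.++⁻ʳ B positiveR , All.map ℕ.≤-pred Z<m)) ,
     ((AllPairs-map-∸ m (ℕ.∸-monoˡ-≤ m) descB , List.length-map _ B) ,
      All.map⁺ (All.map (λ x≤k → subst (_ ≤_) (ℕ.m+n∸m≡n m j) (ℕ.∸-monoˡ-≤ m x≤k)) (All.++⁻ˡ B k≥R)))) ,
    cong₂ _++_ (map-+-∸ k (All.map (λ { (k≤x ∷ _) → k≤x }) A≥)) (cong (λ Y → k ∷ (Y ++ Z)) (map-+-∸ m m≤B))

module FixedHookSummands (m′ j : ℕ) (h : ℤ) where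
  open import Data.Integer using (_+_; _*_; _-_)
  open RowDecomposition m′ j

  -- The summation index s of term₁ is the row of the fixed hook.
  row : ℕ → ℤ
  row t = (+ k - h - + m + + 1) + + t

  CountedBySummand : ℕ → ℕ → List ℕ → Set
  CountedBySummand t n λs = IsPartitionOf n λs × Σ ℕ λ a → + suc a ≡ row t × Image assemble (IsPieces a t) λs

  row-injective : ∀ {a a′ t} → + suc a ≡ row t → + suc a′ ≡ row t → a′ ≡ a
  row-injective eq eq′ = ℕ.suc-injective (ℤ.+-injective (trans eq′ (sym eq)))

  hook-at-row⇔ : ∀ K M H T S → K + (S + T) - S - M + + 1 ≡ S + H ⇔ S ≡ (K - H - M + + 1) + T
  hook-at-row⇔ K M H T S = mk⇔
    (λ hook≡ → begin
      S                                 ≡⟨ add-sub S H ⟩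
      S + H - H                         ≡⟨ cong (_- H) hook≡ ⟨
      K + (S + T) - S - M + + 1 - H     ≡⟨ solve-hook K M H T S ⟩
      (K - H - M + + 1) + T             ∎)
    (λ S≡ → begin
      K + (S + T) - S - M + + 1         ≡⟨ cong (λ S → K + (S + T) - S - M + + 1) S≡ ⟩
      K + (R + T) - R - M + + 1         ≡⟨ solve-hook′ K M H T ⟩
      R + H                             ≡⟨ cong (_+ H) S≡ ⟨
      S + H                             ∎)
    where
    open ≡-Reasoning
    R = (K - H - M + + 1) + T
    add-sub : ∀ S H → S ≡ S + H - H
    add-sub = solve-∀
    solve-hook : ∀ K M H T S → K + (S + T) - S - M + + 1 - H ≡ (K - H - M + + 1) + T
    solve-hook = solve-∀
    solve-hook′ : ∀ K M H T → K + ((K - H - M + + 1) + T + T) - ((K - H - M + + 1) + T) - M + + 1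
                             ≡ (K - H - M + + 1) + T + H
    solve-hook′ = solve-∀

  summand-cong : ∀ {E E′ A A′ G G′ B B′} n → E ≡ E′ → A ≡ A′ → G ≡ G′ → B ≡ B′ →
    shift E (invPochℤ A ⊛ invPoch m′ ⊛ gauss G B) n ≡ shift E′ (invPochℤ A′ ⊛ invPoch m′ ⊛ gauss G′ B′) n
  summand-cong n refl refl refl refl = refl

  term₁≗term₂ : ∀ t → term₁ m k h t ≗ term₂ m k h t
  term₁≗term₂ t n = summand-cong n (exponent (+ k) (+ m) h (+ t)) (index (+ k) (+ m) h (+ t)) (top (+ k) (+ m) h (+ t)) refl
    where
    exponent : ∀ K M H T → ((K - H - M + + 1) + T) * (K + M) + M * (H - K + M - + 1) ≡ T * (K + M) + K * (K - H - M + + 1)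
    exponent = solve-∀
    index : ∀ K M H T → ((K - H - M + + 1) + T) - + 1 ≡ T + K - H - M
    index = solve-∀
    top : ∀ K M H T → ((K - H - M + + 1) + T) + H - + 1 ≡ T + K - M
    top = solve-∀

  term₁-at-row : ∀ a t → + suc a ≡ row t → term₁ m k h t ≗ shiftℕ (baseSize a t) (invPoch a ⊛ invPoch m′ ⊛ box t j)
  term₁-at-row a t a+1≡row n = begin
    term₁ m k h t n
      ≡⟨ summand-cong n exponent (cong (_- + 1) (sym a+1≡row)) (top (+ m) (+ j) h (+ t)) (k-m (+ m) (+ j)) ⟩
    shift (+ baseSize a t) (invPoch a ⊛ invPoch m′ ⊛ gauss (+ (t ℕ.+ j)) (+ j)) n
      ≡⟨ shift-+≗shiftℕ (baseSize a t) _ n ⟩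
    shiftℕ (baseSize a t) (invPoch a ⊛ invPoch m′ ⊛ gauss (+ (t ℕ.+ j)) (+ j)) n
      ≡⟨ shiftℕ-cong (baseSize a t) (⊛-cong (≗-refl {invPoch a ⊛ invPoch m′}) (gauss≗box t j)) n ⟩
    shiftℕ (baseSize a t) (invPoch a ⊛ invPoch m′ ⊛ box t j) n ∎
    where
    open ≡-Reasoning
    exponent-at-row : ∀ K M H T →
      ((K - H - M + + 1) + T) * (K + M) + M * (H - K + M - + 1) ≡ ((K - H - M + + 1) + T) * K + M * T
    exponent-at-row = solve-∀
    exponent : row t * (+ k + + m) + + m * (h - + k + + m - + 1) ≡ + baseSize a t
    exponent = begin
      row t * (+ k + + m) + + m * (h - + k + + m - + 1)  ≡⟨ exponent-at-row (+ k) (+ m) h (+ t) ⟩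
      row t * + k + + m * + t                             ≡⟨ cong (λ S → S * + k + + m * + t) a+1≡row ⟨
      + suc a * + k + + m * + t                           ≡⟨ cong₂ _+_ (ℤ.pos-* (suc a) k) (ℤ.pos-* m t) ⟨
      + baseSize a t                                      ∎
    top : ∀ M J H T → (((M + J) - H - M + + 1) + T) + H - + 1 ≡ T + J
    top = solve-∀
    k-m : ∀ M J → (M + J) - M ≡ J
    k-m = solve-∀

  term₁-off-row : ∀ t → (∀ a → + suc a ≢ row t) → term₁ m k h t ≗ zeroS
  term₁-off-row t off = shift-zeroS (row t * (+ k + + m) + + m * (h - + k + + m - + 1)) (vanishes (row t) off)
    where
    vanishes : ∀ S → (∀ a → + suc a ≢ S) → invPochℤ (S - + 1) ⊛ invPoch m′ ⊛ gauss (S + h - + 1) (+ k - + m) ≗ zeroS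
    vanishes (+ suc a) off = ⊥-elim (off a refl)
    vanishes (+ zero)  _ n = trans (⊛-cong (⊛-zeroˡ (invPoch m′)) (≗-refl {gauss (+ 0 + h - + 1) (+ k - + m)}) n)
                                   (⊛-zeroˡ (gauss (+ 0 + h - + 1) (+ k - + m)) n)
    vanishes -[1+ s ]  _ n = trans (⊛-cong (⊛-zeroˡ (invPoch m′)) (≗-refl {gauss (-[1+ s ] + h - + 1) (+ k - + m)}) n)
                                   (⊛-zeroˡ (gauss (-[1+ s ] + h - + 1) (+ k - + m)) n)

  pieces-generate : ∀ a t → Generates (IsPieces a t) size (invPoch a ⊛ invPoch m′ ⊛ box t j)
  pieces-generate a t =
    generates-⊛ (generates-⊛ (generates-nonincreasingOfLength a) (generates-partitionWithPartsAtMost m′)) (generates-box t j)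

  row-or-not : ∀ S → (Σ ℕ λ a → + suc a ≡ S) ⊎ (∀ a → + suc a ≢ S)
  row-or-not (+ zero)  = inj₂ (λ _ ())
  row-or-not (+ suc a) = inj₁ (a , refl)
  row-or-not -[1+ _ ]  = inj₂ (λ _ ())

  countℤ-summand : ∀ t n → Countℤ (CountedBySummand t n) (term₁ m k h t n)
  countℤ-summand t n with row-or-not (row t)
  ... | inj₂ off-row =
    subst (Countℤ _) (sym (term₁-off-row t off-row n)) (countℤ-∅ λ (_ , a , on-row , _) → off-row a on-row)
  ... | inj₁ (a , on-row) =
    subst (Countℤ _) (sym (term₁-at-row a t on-row n))
      (countℤ-⇔ join split (countℤ-shiftℕ size sum (baseSize a t) assemble (assemble-injective _ _) (sum-assemble _) n
                              (λ d _ → pieces-generate a t d)))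
    where
    join : ∀ {λs} → Image assemble (IsPieces a t) λs × sum λs ≡ n → CountedBySummand t n λs
    join (image@(p , pieces , refl) , sum≡n) =
      let (noninc , positive , _) = assemble-isPartition p pieces in (noninc , positive , sum≡n) , a , on-row , image
    split : ∀ {λs} → CountedBySummand t n λs → Image assemble (IsPieces a t) λs × sum λs ≡ n
    split ((_ , _ , sum≡n) , a′ , on-row′ , image) with row-injective on-row on-row′
    ... | refl = image , sum≡n

  CountedBySummand-≤ : ∀ {t n λs} → CountedBySummand t n λs → t ≤ n
  CountedBySummand-≤ {t} ((_ , _ , sum≡n) , a , _ , p , pieces , refl) = begin
    t                           ≤⟨ ℕ.m≤m+n t (m′ ℕ.* t) ⟩
    m ℕ.* t                     ≤⟨ ℕ.m≤n+m (m ℕ.* t) (suc a ℕ.* k) ⟩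
    baseSize a t                ≤⟨ ℕ.m≤m+n (baseSize a t) (size p) ⟩
    baseSize a t ℕ.+ size p     ≡⟨ trans (sym (sum-assemble p pieces)) sum≡n ⟩
    _                           ∎
    where open ℕ.≤-Reasoning

  CountedBySummand-functional : ∀ {t t′ n λs} → CountedBySummand t n λs → CountedBySummand t′ n λs → t ≡ t′
  CountedBySummand-functional {t} {t′} (_ , a , on-row , p , pieces , refl) (_ , a′ , on-row′ , p′ , pieces′ , same) =
    double-injective t t′ (ℤ.+-injective (begin
      + t + + t                                     ≡⟨ twice (+ k - h - + m + + 1) (+ t) ⟩
      (row t + + t) - (+ k - h - + m + + 1)         ≡⟨ cong (λ S → (S + + t) - (+ k - h - + m + + 1)) on-row ⟨
      (+ suc a + + t) - (+ k - h - + m + + 1)       ≡⟨ cong (λ c → + c - (+ k - h - + m + + 1)) column-m ⟩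
      (+ suc a′ + + t′) - (+ k - h - + m + + 1)     ≡⟨ cong (λ S → (S + + t′) - (+ k - h - + m + + 1)) on-row′ ⟩
      (row t′ + + t′) - (+ k - h - + m + + 1)       ≡⟨ twice (+ k - h - + m + + 1) (+ t′) ⟨
      + t′ + + t′                                   ∎))
    where
    open ≡-Reasoning
    column-m : suc a ℕ.+ t ≡ suc a′ ℕ.+ t′
    column-m = trans (sym (conj-assemble p pieces)) (trans (cong (λ λs → conj λs m) (sym same)) (conj-assemble p′ pieces′))
    twice : ∀ C T → T + T ≡ (C + T + T) - C
    twice = solve-∀
    double-injective : ∀ t t′ → t ℕ.+ t ≡ t′ ℕ.+ t′ → t ≡ t′
    double-injective zero    zero     _  = refl
    double-injective (suc t) (suc t′) eq rewrite ℕ.+-suc t t | ℕ.+-suc t′ t′ =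
      cong suc (double-injective t t′ (ℕ.suc-injective (ℕ.suc-injective eq)))

  hook-assemble : ∀ {a t} p → IsPieces a t p → hook (assemble p) (suc a) m ≡ + k + + (suc a ℕ.+ t) - + suc a - + m + + 1
  hook-assemble p pieces = cong₂ (λ P C → + P + + C - + suc _ - + m + + 1) (part-assemble p pieces) (conj-assemble p pieces)

  fixedHook⇒CountedBySummand : ∀ {n λs} → IsPartitionOf n λs × FixedHookAt m k h λs →
                               Σ ℕ λ t → CountedBySummand t n λs
  fixedHook⇒CountedBySummand (partition , suc a , s≤s z≤n , row-a+1≡k , hook≡) with decompose a partition row-a+1≡k
  ... | t , p , pieces , refl =
    t , partition , a ,
    Equivalence.to (hook-at-row⇔ (+ k) (+ m) h (+ t) (+ suc a)) (trans (sym (hook-assemble p pieces)) hook≡) ,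
    p , pieces , refl

  CountedBySummand⇒fixedHook : ∀ {t n λs} → CountedBySummand t n λs → IsPartitionOf n λs × FixedHookAt m k h λs
  CountedBySummand⇒fixedHook {t} (partition , a , on-row , p , pieces , refl) =
    partition , suc a , s≤s z≤n , part-assemble p pieces ,
    trans (hook-assemble p pieces) (Equivalence.from (hook-at-row⇔ (+ k) (+ m) h (+ t) (+ suc a)) on-row)

  countℤ-partial : ∀ n M → n ≤ M →
    Countℤ (λ λs → IsPartitionOf n λs × FixedHookAt m k h λs) (partial (term₁ m k h) M n)
  countℤ-partial n M n≤M =
    countℤ-⇔ (λ (_ , _ , counted) → CountedBySummand⇒fixedHook counted)
             (λ fixed → let (t , counted) = fixedHook⇒CountedBySummand fixed
                        in t , s≤s (ℕ.≤-trans (CountedBySummand-≤ counted) n≤M) , counted)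
             (countℤ-Σ< (suc M) (λ t → term₁ m k h t n) (λ t _ → countℤ-summand t n) CountedBySummand-functional)

theorem2p2 : (m k : ℕ) (h : ℤ) → 1 ≤ m → m ≤ k →
    (n : ℕ) (L : List (List ℕ)) → Unique L →
    ((p : List ℕ) → (p ∈ L) ⇔ (IsPartitionOf n p × FixedHookAt m k h p)) →
    HasCoeff (term₁ m k h) n (+ length L) × HasCoeff (term₂ m k h) n (+ length L)
theorem2p2 (suc m′) k h (s≤s z≤n) m≤k n L L-unique L⇔ with ℕ.m≤n⇒∃[o]m+o≡n m≤k
... | j , refl = (n , partial₁≡) , (n , λ M n≤M → trans (partial₂≡partial₁ M) (partial₁≡ M n≤M))
  where
  open FixedHookSummands m′ j h
  enumeration : Count (λ p → IsPartitionOf n p × FixedHookAt (suc m′) (suc m′ ℕ.+ j) h p) (length L)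
  enumeration = record
    { elements = L ; unique = L-unique ; sound = Equivalence.to (L⇔ _)
    ; complete = Equivalence.from (L⇔ _) ; length≡ = refl }
  partial₁≡ : ∀ M → n ≤ M → partial (term₁ _ _ h) M n ≡ + length L
  partial₁≡ M n≤M = countℤ-value enumeration (countℤ-partial n M n≤M)
  partial₂≡partial₁ : ∀ M → partial (term₂ _ _ h) M n ≡ partial (term₁ _ _ h) M n
  partial₂≡partial₁ M = sumTo-cong (suc M) (λ t _ → sym (term₁≗term₂ t n))
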